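{- Let $\mathbf{w}$ be a biinfinite Sturmian word and $n$ a nonnegative integer. 1. $Q_{\mathbf{w}}(n)=0$ if and only if $\mathbf{w}$ has a nonempty bispecial factor of length $n-1$. 2. If $Q_{\mathbf{w}}(n)>0$ and $s$ denotes the shortest bispecial factor of $\mathbf{w}$ with $|s|\ge n$, then the quasiperiods of length $n$ of $\mathbf{w}$ are exactly the factors of length $n$ of $s$.
   Context: Biinfinite words are indexed by $\mathbb{Z}$. A biinfinite word $\mathbf{w}$ is Sturmian if it is not eventually periodic and, for every $n\ge0$, it has exactly $n+1$ distinct factors of length $n$. A finite word $u$ is a quasiperiod of $\mathbf{w}$ if every position of $\mathbf{w}$ lies in some occurrence of $u$; $Q_{\mathbf{w}}(n)$ is the number of quasiperiods of length $n$ of $\mathbf{w}$. A factor $u$ is right special if $u\alpha,u\beta$ are factors for two distinct letters $\alpha,\beta$, left special if $\alpha u,\beta u$ are, and bispecial if it is both left and right special. -}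

module Defs where

open import Data.Nat using (ℕ; zero; suc; _≤_; _<_)
open import Data.Integer as ℤ using (ℤ; +_)
open import Data.Fin using (Fin; toℕ)
open import Data.List using (List; []; _∷_; _++_; length; lookup; [_])
open import Data.List.Relation.Unary.All using (All)
open import Data.List.Relation.Unary.Unique.Propositional using (Unique)
open import Data.List.Membership.Propositional using (_∈_)
open import Data.List.Relation.Binary.Infix.Heterogeneous using (Infix)
open import Data.Product using (Σ; ∃; ∃-syntax; _×_)
open import Relation.Binary.PropositionalEquality using (_≡_; _≢_)
open import Relation.Nullary using (¬_)

BiWord : Set → Set
BiWord A = ℤ → A

OccursAt : {A : Set} → BiWord A → List A → ℤ → Set
OccursAt w u i = (k : Fin (length u)) → w (i ℤ.+ + toℕ k) ≡ lookup u k

Factor : {A : Set} → BiWord A → List A → Set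
Factor w u = ∃[ i ] OccursAt w u i

HasCount : {X : Set} → (X → Set) → ℕ → Set
HasCount {X} P k =
  Σ (List X) λ xs → (length xs ≡ k) × Unique xs × All P xs × ((x : X) → P x → x ∈ xs)

FactorOfLength : {A : Set} → BiWord A → ℕ → List A → Set
FactorOfLength w n u = (length u ≡ n) × Factor w u

EventuallyPeriodic : {A : Set} → BiWord A → Set
EventuallyPeriodic w =
  ∃[ p ] (1 ≤ p) × ∃[ N ] ((i : ℤ) → N ℤ.≤ i → w (i ℤ.+ + p) ≡ w i)

Sturmian : {A : Set} → BiWord A → Set
Sturmian w = ¬ EventuallyPeriodic w × ((n : ℕ) → HasCount (FactorOfLength w n) (suc n))

Quasiperiod : {A : Set} → BiWord A → List A → Set
Quasiperiod w u =
  (p : ℤ) → ∃[ i ] OccursAt w u i × (i ℤ.≤ p) × (p ℤ.< i ℤ.+ + length u)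

QuasiperiodOfLength : {A : Set} → BiWord A → ℕ → List A → Set
QuasiperiodOfLength w n u = (length u ≡ n) × Quasiperiod w u

QCount : {A : Set} → BiWord A → ℕ → ℕ → Set
QCount w n k = HasCount (QuasiperiodOfLength w n) k

RightSpecial : {A : Set} → BiWord A → List A → Set
RightSpecial w u = ∃[ α ] ∃[ β ] (α ≢ β) × Factor w (u ++ [ α ]) × Factor w (u ++ [ β ])

LeftSpecial : {A : Set} → BiWord A → List A → Set
LeftSpecial w u = ∃[ α ] ∃[ β ] (α ≢ β) × Factor w (α ∷ u) × Factor w (β ∷ u)

Bispecial : {A : Set} → BiWord A → List A → Set
Bispecial w u = Factor w u × LeftSpecial w u × RightSpecial w u

FiniteFactor : {A : Set} → List A → List A → Set
FiniteFactor u s = Infix _≡_ u s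

{-# OPTIONS --safe #-}

-- Map each position of w to the factor of length n starting there, a vertex of the Rauzy graph
-- of order n.  This graph has n + 1 vertices and one right special vertex R, and w runs around
-- the two circuits leaving R along its two outgoing edges; they share a tail of d + 1 vertices,
-- from the left special vertex M to R.  A factor u of length n is a quasiperiod iff every window
-- of n consecutive positions contains the start of an occurrence of u.  A vertex private to one
-- circuit misses some window, because by aperiodicity that circuit is somewhere followed by the
-- other one; a tail vertex meets every window iff both circuits have private vertices, i.e. both
-- have length at most n.  A circuit without private vertices is an edge R → M, which amounts to
-- a bispecial factor of length n − 1.  Otherwise the word of length n + d read from M to R is the
-- shortest bispecial factor of length at least n, and its factors of length n are the tail
-- vertices.

module Submission where

open import Defs
open import Data.Nat using (ℕ; zero; suc; _+_; _*_; _∸_; _≤_; _<_; z≤n; s≤s; _≤?_; _<?_)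
open import Data.Nat.Properties
open import Data.Nat.DivMod using (_/_; _%_; m≡m%n+[m/n]*n; m%n<n; [m+n]%n≡m%n)
open import Data.Nat.Induction using (<-rec)
open import Data.Integer as ℤ using (ℤ; -[1+_])
import Data.Integer.Properties as ℤP
open import Data.Integer.Solver using (module +-*-Solver)
open import Data.Fin as F using (Fin; toℕ; fromℕ<)
open import Data.Fin.Patterns using (0F; 1F)
import Data.Fin.Properties as FP
open import Data.Bool using (Bool; true; false; not) renaming (_≟_ to _≟ᵇ_)
open import Data.Bool.Properties using (¬-not; not-involutive)
open import Data.List using (List; []; _∷_; _++_; length; lookup; [_])
open import Data.List.Properties using (∷-injective; ∷ʳ-injective; length-++)
open import Data.List.Relation.Unary.All as All using (All; []; _∷_)
open import Data.List.Relation.Unary.Any as Any using (here; there)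
open import Data.List.Relation.Unary.Any.Properties using (lookup-index; ¬Any[])
open import Data.List.Relation.Unary.AllPairs using ([]; _∷_)
open import Data.List.Relation.Unary.Unique.Propositional using (Unique)
open import Data.List.Membership.Propositional using (_∈_)
open import Data.List.Membership.Propositional.Properties using (∈-lookup)
open import Data.List.Relation.Binary.Infix.Heterogeneous using (Infix; here; there)
open import Data.List.Relation.Binary.Prefix.Heterogeneous using (Prefix; []; _∷_)
open import Data.Product using (∃; ∃-syntax; _×_; _,_; proj₁; proj₂)
open import Data.Sum using (_⊎_; inj₁; inj₂)
open import Data.Empty using (⊥-elim)
open import Function using (_∘_; case_of_)
open import Function.Bundles using (_⇔_; mk⇔)
open import Relation.Nullary using (¬_; Dec; yes; no)
open import Relation.Nullary.Decidable using (¬?; decidable-stable)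
open import Relation.Unary using (Pred; Decidable)
open import Relation.Binary.Definitions using (tri<; tri≈; tri>)
open import Relation.Binary.PropositionalEquality
  using (_≡_; _≢_; refl; sym; trans; cong; cong₂; subst; subst₂; module ≡-Reasoning)

infixl 6 _⊕_ _⊖_

_⊕_ : ℤ → ℕ → ℤ
x ⊕ k = x ℤ.+ ℤ.+ k

_⊖_ : ℤ → ℕ → ℤ
x ⊖ k = x ℤ.- ℤ.+ k

module _ where
  open +-*-Solver

  ⊕-identityʳ : ∀ x → x ⊕ 0 ≡ x
  ⊕-identityʳ = ℤP.+-identityʳ

  ⊖-identityʳ : ∀ x → x ⊖ 0 ≡ x
  ⊖-identityʳ = ℤP.+-identityʳ

  ⊕-assoc : ∀ x a b → x ⊕ a ⊕ b ≡ x ⊕ (a + b)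
  ⊕-assoc x a b = trans (ℤP.+-assoc x (ℤ.+ a) (ℤ.+ b)) (cong (ℤ._+_ x) (sym (ℤP.pos-+ a b)))

  x⊕a⊕1≡x⊕1+a : ∀ x a → x ⊕ a ⊕ 1 ≡ x ⊕ suc a
  x⊕a⊕1≡x⊕1+a x a = trans (⊕-assoc x a 1) (cong (x ⊕_) (+-comm a 1))

  x⊖a⊕a≡x : ∀ x a → x ⊖ a ⊕ a ≡ x
  x⊖a⊕a≡x x a = solve 2 (λ x a → x :- a :+ a := x) refl x (ℤ.+ a)

  x⊖a⊕[a+b]≡x⊕b : ∀ x a b → x ⊖ a ⊕ (a + b) ≡ x ⊕ b
  x⊖a⊕[a+b]≡x⊕b x a b rewrite ℤP.pos-+ a b =
    solve 3 (λ x a b → x :- a :+ (a :+ b) := x :+ b) refl x (ℤ.+ a) (ℤ.+ b)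

  x⊖[a+b]⊕a≡x⊖b : ∀ x a b → x ⊖ (a + b) ⊕ a ≡ x ⊖ b
  x⊖[a+b]⊕a≡x⊖b x a b rewrite ℤP.pos-+ a b =
    solve 3 (λ x a b → x :- (a :+ b) :+ a := x :- b) refl x (ℤ.+ a) (ℤ.+ b)

  x⊕[a+b]⊖b≡x⊕a : ∀ x a b → x ⊕ (a + b) ⊖ b ≡ x ⊕ a
  x⊕[a+b]⊖b≡x⊕a x a b rewrite ℤP.pos-+ a b =
    solve 3 (λ x a b → x :+ (a :+ b) :- b := x :+ a) refl x (ℤ.+ a) (ℤ.+ b)

  x⊕[a+b]⊖a≡x⊕b : ∀ x a b → x ⊕ (a + b) ⊖ a ≡ x ⊕ b
  x⊕[a+b]⊖a≡x⊕b x a b rewrite ℤP.pos-+ a b =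
    solve 3 (λ x a b → x :+ (a :+ b) :- a := x :+ b) refl x (ℤ.+ a) (ℤ.+ b)

  x⊖a⊕b⊕a≡x⊕b : ∀ x a b → x ⊖ a ⊕ b ⊕ a ≡ x ⊕ b
  x⊖a⊕b⊕a≡x⊕b x a b = solve 3 (λ x a b → x :- a :+ b :+ a := x :+ b) refl x (ℤ.+ a) (ℤ.+ b)

  x⊖b⊕a⊕1+b≡x⊕1+a : ∀ x a b → x ⊖ b ⊕ a ⊕ suc b ≡ x ⊕ suc a
  x⊖b⊕a⊕1+b≡x⊕1+a x a b rewrite ℤP.pos-+ 1 a | ℤP.pos-+ 1 b =
    solve 4 (λ x a b o → x :- b :+ a :+ (o :+ b) := x :+ (o :+ a)) refl x (ℤ.+ a) (ℤ.+ b) (ℤ.+ 1)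

  x⊖a⊖b≡x⊖[a+b] : ∀ x a b → x ⊖ a ⊖ b ≡ x ⊖ (a + b)
  x⊖a⊖b≡x⊖[a+b] x a b rewrite ℤP.pos-+ a b =
    solve 3 (λ x a b → x :- a :- b := x :- (a :+ b)) refl x (ℤ.+ a) (ℤ.+ b)

  x⊖1+a⊕1+b≡x⊕b⊖a : ∀ x a b → x ⊖ suc a ⊕ suc b ≡ x ⊕ b ⊖ a
  x⊖1+a⊕1+b≡x⊕b⊖a x a b rewrite ℤP.pos-+ 1 a | ℤP.pos-+ 1 b =
    solve 4 (λ x a b o → x :- (o :+ a) :+ (o :+ b) := x :+ b :- a) refl x (ℤ.+ a) (ℤ.+ b) (ℤ.+ 1)

  ⊕-or-⊖suc : ∀ x i → (∃ λ m → i ≡ x ⊕ m) ⊎ (∃ λ m → i ≡ x ⊖ suc m)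
  ⊕-or-⊖suc x i with i ℤ.- x in eq
  ... | ℤ.+ m    = inj₁ (m , trans (solve 2 (λ i x → i := x :+ (i :- x)) refl i x) (cong (ℤ._+_ x) eq))
  ... | -[1+ m ] = inj₂ (m , trans (solve 2 (λ i x → i := x :+ (i :- x)) refl i x) (cong (ℤ._+_ x) eq))

  ⊕-cancelˡ-≤ : ∀ x a b → x ⊕ a ℤ.≤ x ⊕ b → a ≤ b
  ⊕-cancelˡ-≤ x a b h =
    ℤP.drop‿+≤+ (subst₂ ℤ._≤_ (-x+[x⊕c]≡c a) (-x+[x⊕c]≡c b) (ℤP.+-monoʳ-≤ (ℤ.- x) h))
    where
    -x+[x⊕c]≡c : ∀ c → ℤ.- x ℤ.+ (x ⊕ c) ≡ ℤ.+ c
    -x+[x⊕c]≡c c = solve 2 (λ x c → :- x :+ (x :+ c) := c) refl x (ℤ.+ c)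

x≤x⊕a : ∀ x a → x ℤ.≤ x ⊕ a
x≤x⊕a x a = subst (ℤ._≤ x ⊕ a) (⊕-identityʳ x) (ℤP.+-monoʳ-≤ x (ℤ.+≤+ z≤n))

x<x⊕1+a : ∀ x a → x ℤ.< x ⊕ suc a
x<x⊕1+a x a = subst (ℤ._< x ⊕ suc a) (⊕-identityʳ x) (ℤP.+-monoʳ-< x (ℤ.+<+ (s≤s z≤n)))

x⊖a≤x : ∀ x a → x ⊖ a ℤ.≤ x
x⊖a≤x x a = subst (x ⊖ a ℤ.≤_) (x⊖a⊕a≡x x a) (x≤x⊕a (x ⊖ a) a)

x⊖1+a<x : ∀ x a → x ⊖ suc a ℤ.< x
x⊖1+a<x x a = subst (x ⊖ suc a ℤ.<_) (x⊖a⊕a≡x x (suc a)) (x<x⊕1+a (x ⊖ suc a) a)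

least : ∀ {p} {P : Pred ℕ p} → Decidable P → ∀ k → P k →
        ∃ λ m → m ≤ k × P m × (∀ j → j < m → ¬ P j)
least P? k pk with P? 0
... | yes p0 = 0 , z≤n , p0 , λ _ ()
least P? zero    p0  | no ¬p0 = ⊥-elim (¬p0 p0)
least P? (suc k) psk | no ¬p0 with least (P? ∘ suc) k psk
... | m , m≤k , pm , below = suc m , s≤s m≤k , pm , λ where
  zero    _         → ¬p0
  (suc j) (s≤s j<m) → below j j<m

a<b⇒a+u≡b⇒0<u : ∀ {a b u} → a < b → a + u ≡ b → 0 < u
a<b⇒a+u≡b⇒0<u {a} {u = zero}  a<b a+0≡b = ⊥-elim (<-irrefl (trans (sym (+-identityʳ a)) a+0≡b) a<b)
a<b⇒a+u≡b⇒0<u     {u = suc _} _   _     = s≤s z≤n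

offset-in-window : ∀ {n T} j t u o → j + o ≡ T → t + u ≡ o → T ≤ n → u < n ⊎ (t ≡ 0 × j ≡ 0)
offset-in-window j (suc t) u o j+o≡T refl T≤n =
  inj₁ (<-≤-trans (s≤s (m≤n+m u t)) (≤-trans (subst (suc t + u ≤_) j+o≡T (m≤n+m _ j)) T≤n))
offset-in-window (suc j) zero u o j+o≡T refl T≤n = inj₁ (<-≤-trans (subst (u <_) j+o≡T (m<n+m u (s≤s z≤n))) T≤n)
offset-in-window zero zero _ _ _ _ _ = inj₂ (refl , refl)

fin2-≢⇒≡⊎≡ : (a b c : Fin 2) → a ≢ b → c ≡ a ⊎ c ≡ b
fin2-≢⇒≡⊎≡ 0F 0F _  a≢b = ⊥-elim (a≢b refl)
fin2-≢⇒≡⊎≡ 0F 1F 0F _   = inj₁ refl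
fin2-≢⇒≡⊎≡ 0F 1F 1F _   = inj₂ refl
fin2-≢⇒≡⊎≡ 1F 0F 0F _   = inj₂ refl
fin2-≢⇒≡⊎≡ 1F 0F 1F _   = inj₁ refl
fin2-≢⇒≡⊎≡ 1F 1F _  a≢b = ⊥-elim (a≢b refl)

-- Positions x : X are classified by their factor of length m (short), of length m + 1 (long),
-- and the letter following the short factor (next).  A short class is special when next varies
-- on it; a special class splits into two long classes and every other one into one, so with
-- m + 1 short and m + 2 long classes exactly one short class is special.
module SpecialClass {X : Set} (m : ℕ)
  (short : X → Fin (suc m)) (long : X → Fin (suc (suc m))) (next : X → Fin 2)
  (long⇒short : ∀ x y → long x ≡ long y → short x ≡ short y)
  (long⇒next : ∀ x y → long x ≡ long y → next x ≡ next y)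
  (short×next⇒long : ∀ x y → short x ≡ short y → next x ≡ next y → long x ≡ long y)
  (short⁻¹ : Fin (suc m) → X) (short∘short⁻¹ : ∀ k → short (short⁻¹ k) ≡ k)
  (long⁻¹ : Fin (suc (suc m)) → X) (long∘long⁻¹ : ∀ k → long (long⁻¹ k) ≡ k) where

  Special : X → X → Set
  Special x y = short x ≡ short y × next x ≢ next y

  opaque
    special-exists : ∃ λ x → ∃ λ y → Special x y
    special-exists with FP.pigeonhole (n<1+n (suc m)) (short ∘ long⁻¹)
    ... | i , j , i<j , same =
      long⁻¹ i , long⁻¹ j , same , λ e → FP.<-irrefl (long⁻¹-injective (short×next⇒long _ _ same e)) i<j
      where
      long⁻¹-injective : long (long⁻¹ i) ≡ long (long⁻¹ j) → i ≡ j
      long⁻¹-injective e = trans (sym (long∘long⁻¹ i)) (trans e (long∘long⁻¹ j))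

  private
    representative : X → X
    representative x = short⁻¹ (short x)

    off-representative : ∀ {x y} → Special x y → ∃ λ z → short z ≡ short x × next z ≢ next (representative x)
    off-representative {x} {y} (same , differ) with fin2-≢⇒≡⊎≡ (next x) (next y) (next (representative x)) differ
    ... | inj₁ r≡x = y , sym same , λ e → differ (trans (sym r≡x) (sym e))
    ... | inj₂ r≡y = x , refl , λ e → differ (trans e r≡y)

    off-representative-long : ∀ {x z} → short z ≡ short x → next z ≢ next (representative x) →
                              ∀ k → long z ≢ long (short⁻¹ k)
    off-representative-long {x} {z} z~x differ k e = differ (trans (long⇒next _ _ e) (cong (next ∘ short⁻¹) k≡sx))
      where
      k≡sx : k ≡ short x
      k≡sx = trans (sym (short∘short⁻¹ k)) (trans (sym (long⇒short _ _ e)) z~x)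

  opaque
    special-unique : ∀ {x y x' y'} → Special x y → Special x' y' → short x ≡ short x'
    special-unique {x} {x' = x'} sp sp' with short x F.≟ short x' | off-representative sp | off-representative sp'
    ... | yes eq | _ | _ = eq
    ... | no neq | z , z~x , z≁ | z' , z'~x' , z'≁ =
      ⊥-elim (1+n≰n (FP.injective⇒≤ {f = long ∘ point} (point-separated _ _)))
      where
      point : Fin (3 + m) → X
      point 0F                = z
      point 1F                = z'
      point (F.suc (F.suc k)) = short⁻¹ k

      point-separated : ∀ i j → long (point i) ≡ long (point j) → i ≡ j
      point-separated 0F 0F _ = refl
      point-separated 1F 1F _ = refl
      point-separated 0F 1F e = ⊥-elim (neq (trans (sym z~x) (trans (long⇒short _ _ e) z'~x')))
      point-separated 1F 0F e = ⊥-elim (neq (trans (sym z~x) (trans (long⇒short _ _ (sym e)) z'~x')))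
      point-separated 0F (F.suc (F.suc k)) e = ⊥-elim (off-representative-long z~x z≁ k e)
      point-separated 1F (F.suc (F.suc k)) e = ⊥-elim (off-representative-long z'~x' z'≁ k e)
      point-separated (F.suc (F.suc k)) 0F e = ⊥-elim (off-representative-long z~x z≁ k (sym e))
      point-separated (F.suc (F.suc k)) 1F e = ⊥-elim (off-representative-long z'~x' z'≁ k (sym e))
      point-separated (F.suc (F.suc k)) (F.suc (F.suc k')) e =
        cong (F.suc ∘ F.suc) (trans (sym (short∘short⁻¹ k)) (trans (long⇒short _ _ e) (short∘short⁻¹ k')))

-- C x is the vertex of the Rauzy graph of order n (the factor of length n) read at position x,
-- and R its right special vertex, left along the two branches γ taken at the positions r γ.
module Circuits (n : ℕ) (C : ℤ → Fin (suc n)) (R : Fin (suc n))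
  (deterministic : ∀ x y → C x ≡ C y → C x ≢ R → C (x ⊕ 1) ≡ C (y ⊕ 1))
  (aperiodic : ∀ x p → 1 ≤ p → ¬ (∀ m → C (x ⊕ (m + p)) ≡ C (x ⊕ m)))
  (r : Bool → ℤ) (r-R : ∀ γ → C (r γ) ≡ R)
  (branches-differ : C (r true ⊕ 1) ≢ C (r false ⊕ 1))
  (branch : ∀ x → C x ≡ R → ∃ λ γ → C (x ⊕ 1) ≡ C (r γ ⊕ 1))
  (C-onto : ∀ c → ∃ λ z → C z ≡ c) where

  R? : ∀ x → Dec (C x ≡ R)
  R? x = C x F.≟ R

  same-path : ∀ x y K → C x ≡ C y → (∀ m → m < K → C (x ⊕ m) ≢ R) →
              ∀ m → m ≤ K → C (x ⊕ m) ≡ C (y ⊕ m)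
  same-path x y K e avoid zero _ = trans (cong C (⊕-identityʳ x)) (trans e (cong C (sym (⊕-identityʳ y))))
  same-path x y K e avoid (suc m) 1+m≤K =
    trans (cong C (sym (x⊕a⊕1≡x⊕1+a x m)))
      (trans (deterministic _ _ (same-path x y K e avoid m (<⇒≤ 1+m≤K)) (avoid m 1+m≤K))
        (cong C (x⊕a⊕1≡x⊕1+a y m)))

  opaque
    -- Off R the successor is determined, so a repeat with no R in between would repeat forever.
    periodic-meets-R : ∀ x p → 1 ≤ p → C x ≡ C (x ⊕ p) → ¬ (∀ t → t < p → C (x ⊕ t) ≢ R)
    periodic-meets-R x p 1≤p e0 avoid = aperiodic x p 1≤p (λ m → sym (proj₁ (<-rec Invariant step m)))
      where
      Invariant : ℕ → Set
      Invariant m = C (x ⊕ m) ≡ C (x ⊕ (m + p)) × C (x ⊕ m) ≢ R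

      avoids : ∀ m → (∀ {k} → k < m → Invariant k) → C (x ⊕ m) ≢ R
      avoids m below with m <? p
      ... | yes m<p = avoid m m<p
      ... | no m≮p with m≤n⇒∃[o]m+o≡n (≮⇒≥ m≮p)
      ... | k , p+k≡m = λ eq → proj₂ (below k<m) (trans (proj₁ (below k<m)) (trans (cong (C ∘ (x ⊕_)) k+p≡m) eq))
        where
        k+p≡m : k + p ≡ m
        k+p≡m = trans (+-comm k p) p+k≡m
        k<m : k < m
        k<m = subst (k <_) k+p≡m (subst (_≤ k + p) (+-comm k 1) (+-monoʳ-≤ k 1≤p))

      step : ∀ m → (∀ {k} → k < m → Invariant k) → Invariant m
      step zero below = trans (cong C (⊕-identityʳ x)) e0 , avoids zero below
      step (suc k) below =
        trans (cong C (sym (x⊕a⊕1≡x⊕1+a x k)))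
          (trans (deterministic _ _ (proj₁ (below ≤-refl)) (proj₂ (below ≤-refl)))
            (cong C (x⊕a⊕1≡x⊕1+a x (k + p)))) ,
        avoids (suc k) below

    repeat-meets-R : ∀ x a b → a < b → C (x ⊕ a) ≡ C (x ⊕ b) → ¬ (∀ t → a ≤ t → t < b → C (x ⊕ t) ≢ R)
    repeat-meets-R x a b a<b e avoid with m≤n⇒∃[o]m+o≡n (<⇒≤ a<b)
    ... | u , a+u≡b = periodic-meets-R (x ⊕ a) u 1≤u
      (trans e (cong C (sym (trans (⊕-assoc x a u) (cong (x ⊕_) a+u≡b)))))
      (λ t t<u eq → avoid (a + t) (m≤m+n a t) (subst (a + t <_) a+u≡b (+-monoʳ-< a t<u))
                      (trans (cong C (sym (⊕-assoc x a t))) eq))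
      where
      1≤u : 1 ≤ u
      1≤u = a<b⇒a+u≡b⇒0<u a<b a+u≡b

    R-within : ∀ p → ∃ λ t → t ≤ suc n × C (p ⊕ t) ≡ R
    R-within p with anyUpTo? (λ t → R? (p ⊕ t)) (suc (suc n))
    ... | yes (t , t<2+n , e) = t , ≤-pred t<2+n , e
    ... | no none with FP.pigeonhole (n<1+n (suc n)) (λ i → C (p ⊕ toℕ i))
    ... | i , j , i<j , e = ⊥-elim (repeat-meets-R p (toℕ i) (toℕ j) i<j e
                              (λ t _ t<j eq → none (t , <-trans t<j (FP.toℕ<n j) , eq)))

    next-R : ∀ p → ∃ λ t → C (p ⊕ t) ≡ R × (∀ s → s < t → C (p ⊕ s) ≢ R)
    next-R p with R-within p
    ... | t , _ , e with least (λ t → R? (p ⊕ t)) t e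
    ... | m , _ , pm , below = m , pm , below

    last-R : ∀ z → ∃ λ t → C (z ⊖ t) ≡ R × (∀ s → s < t → C (z ⊖ s) ≢ R)
    last-R z with R-within (z ⊖ suc n)
    ... | t , t≤1+n , e with m≤n⇒∃[o]m+o≡n t≤1+n
    ... | u , t+u≡1+n with least (λ t → R? (z ⊖ t)) u
                             (trans (cong C (sym (trans (cong (λ k → z ⊖ k ⊕ t) (sym t+u≡1+n))
                                                        (x⊖[a+b]⊕a≡x⊖b z t u)))) e)
    ... | m , _ , pm , below = m , pm , below

    first-return : ∀ γ → ∃ λ t → C (r γ ⊕ 1 ⊕ t) ≡ R × (∀ s → s < t → C (r γ ⊕ 1 ⊕ s) ≢ R)
    first-return γ = next-R (r γ ⊕ 1)

  -- Circuit γ leaves R along branch γ at position r γ and is back at R after T γ steps;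
  -- W γ t is its vertex after t steps.
  T : Bool → ℕ
  T γ = suc (proj₁ (first-return γ))

  W : Bool → ℕ → Fin (suc n)
  W γ t = C (r γ ⊕ t)

  opaque
    W-start : ∀ γ → W γ 0 ≡ R
    W-start γ = trans (cong C (⊕-identityʳ _)) (r-R γ)

    W-end : ∀ γ → W γ (T γ) ≡ R
    W-end γ = trans (cong C (sym (⊕-assoc (r γ) 1 _))) (proj₁ (proj₂ (first-return γ)))

    W-avoids-R : ∀ γ t → 1 ≤ t → t < T γ → W γ t ≢ R
    W-avoids-R γ (suc s) _ (s≤s s<) e = proj₂ (proj₂ (first-return γ)) s s< (trans (cong C (⊕-assoc (r γ) 1 s)) e)

    follows-circuit : ∀ γ x → C x ≡ R → C (x ⊕ 1) ≡ W γ 1 → ∀ t → t ≤ T γ → C (x ⊕ t) ≡ W γ t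
    follows-circuit γ x xR x1 zero _ = trans (cong C (⊕-identityʳ x)) (trans xR (sym (W-start γ)))
    follows-circuit γ x xR x1 (suc t) (s≤s t≤) =
      trans (cong C (sym (⊕-assoc x 1 t)))
        (sym (trans (cong C (sym (⊕-assoc (r γ) 1 t)))
          (same-path (r γ ⊕ 1) (x ⊕ 1) _ (sym x1) (proj₂ (proj₂ (first-return γ))) t t≤)))

    circuits-branch-apart : ∀ γ → W γ 1 ≢ W (not γ) 1
    circuits-branch-apart true  e = branches-differ e
    circuits-branch-apart false e = branches-differ (sym e)

    W≡R⇒0 : ∀ γ t → t < T γ → W γ t ≡ R → t ≡ 0
    W≡R⇒0 γ zero    _   _ = refl
    W≡R⇒0 γ (suc t) t<T e = ⊥-elim (W-avoids-R γ (suc t) (s≤s z≤n) t<T e)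

    W-injective₁ : ∀ γ i j → 1 ≤ i → 1 ≤ j → i ≤ T γ → j ≤ T γ → W γ i ≡ W γ j → i ≡ j
    W-injective₁ γ i j 1≤i 1≤j i≤T j≤T e with <-cmp i j
    ... | tri< i<j _ _ = ⊥-elim (repeat-meets-R (r γ) i j i<j e
                           (λ t i≤t t<j → W-avoids-R γ t (≤-trans 1≤i i≤t) (<-≤-trans t<j j≤T)))
    ... | tri≈ _ i≡j _ = i≡j
    ... | tri> _ _ j<i = ⊥-elim (repeat-meets-R (r γ) j i j<i (sym e)
                           (λ t j≤t t<i → W-avoids-R γ t (≤-trans 1≤j j≤t) (<-≤-trans t<i i≤T)))

    W-injective₀ : ∀ γ i j → i < T γ → j < T γ → W γ i ≡ W γ j → i ≡ j
    W-injective₀ γ zero    zero    _   _   _ = refl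
    W-injective₀ γ zero    (suc j) _   j<T e = sym (W≡R⇒0 γ (suc j) j<T (trans (sym e) (W-start γ)))
    W-injective₀ γ (suc i) zero    i<T _   e = W≡R⇒0 γ (suc i) i<T (trans e (W-start γ))
    W-injective₀ γ (suc i) (suc j) i<T j<T e =
      W-injective₁ γ (suc i) (suc j) (s≤s z≤n) (s≤s z≤n) (<⇒≤ i<T) (<⇒≤ j<T) e

  -- S γ j is the vertex j steps before circuit γ returns to R.  The two circuits share exactly
  -- their last d + 1 vertices S γ 0 … S γ d, and M = S γ d is where they merge.
  S : Bool → ℕ → Fin (suc n)
  S γ j = C (r γ ⊕ T γ ⊖ j)

  opaque
    W≡S : ∀ γ t j → t + j ≡ T γ → W γ t ≡ S γ j
    W≡S γ t j t+j≡T = cong C (sym (trans (cong (λ k → r γ ⊕ k ⊖ j) (sym t+j≡T)) (x⊕[a+b]⊖b≡x⊕a (r γ) t j)))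

    S-start : ∀ γ → S γ 0 ≡ R
    S-start γ = trans (cong C (⊖-identityʳ _)) (W-end γ)

  Diverge : ℕ → Set
  Diverge j = S true (suc j) ≢ S false (suc j)

  Diverge? : ∀ j → Dec (Diverge j)
  Diverge? j = ¬? (S true (suc j) F.≟ S false (suc j))

  opaque
    shorter-circuit-diverges : ∀ γ → T γ < T (not γ) → S γ (T γ) ≢ S (not γ) (T γ)
    shorter-circuit-diverges γ T<T' e with m≤n⇒∃[o]m+o≡n (<⇒≤ T<T')
    ... | u , T+u≡T' =
      W-avoids-R (not γ) u (a<b⇒a+u≡b⇒0<u T<T' T+u≡T') (subst (u <_) T+u≡T' (m<n+m u (s≤s z≤n)))
        (trans (W≡S (not γ) u (T γ) (trans (+-comm u (T γ)) T+u≡T'))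
          (trans (sym e) (trans (sym (W≡S γ 0 (T γ) refl)) (W-start γ))))

    equal-circuits-diverge : ∀ t → T true ≡ t → T true ≡ T false →
                             ∃ λ j → suc j ≤ T true × suc j ≤ T false × Diverge j
    equal-circuits-diverge zero          T≡t _ = ⊥-elim (1+n≢0 T≡t)
    equal-circuits-diverge (suc zero)    T≡t T≡T' = ⊥-elim (branches-differ
      (trans (subst (λ k → W true k ≡ R) T≡t (W-end true))
        (sym (subst (λ k → W false k ≡ R) (trans (sym T≡T') T≡t) (W-end false)))))
    equal-circuits-diverge (suc (suc k)) T≡t T≡T' =
      k , subst (suc k ≤_) (sym T≡t) (n≤1+n (suc k)) , subst (suc k ≤_) (trans (sym T≡t) T≡T') (n≤1+n (suc k)) ,
      λ e → branches-differ (trans (W≡S true 1 (suc k) (sym T≡t))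
                               (trans e (sym (W≡S false 1 (suc k) (trans (sym T≡t) T≡T')))))

    diverge-somewhere : ∃ λ j → suc j ≤ T true × suc j ≤ T false × Diverge j
    diverge-somewhere with <-cmp (T true) (T false)
    ... | tri< T<T' _ _ = proj₁ (first-return true) , ≤-refl , <⇒≤ T<T' , shorter-circuit-diverges true T<T'
    ... | tri≈ _ T≡T' _ = equal-circuits-diverge (T true) refl T≡T'
    ... | tri> _ _ T'<T =
      proj₁ (first-return false) , <⇒≤ T'<T , ≤-refl , λ e → shorter-circuit-diverges false T'<T (sym e)

    first-divergence : ∃ λ m → m ≤ proj₁ diverge-somewhere × Diverge m × (∀ j → j < m → ¬ Diverge j)
    first-divergence = least Diverge? _ (proj₂ (proj₂ (proj₂ diverge-somewhere)))

  d : ℕ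
  d = proj₁ first-divergence

  M : Fin (suc n)
  M = S true d

  M-position : ℤ
  M-position = r true ⊕ T true ⊖ d

  opaque
    C-M-position : C M-position ≡ M
    C-M-position = refl

    d<T : ∀ γ → suc d ≤ T γ
    d<T true  = ≤-trans (s≤s (proj₁ (proj₂ first-divergence))) (proj₁ (proj₂ diverge-somewhere))
    d<T false = ≤-trans (s≤s (proj₁ (proj₂ first-divergence))) (proj₁ (proj₂ (proj₂ diverge-somewhere)))

    S-diverge : ∀ γ → S γ (suc d) ≢ S (not γ) (suc d)
    S-diverge true  = proj₁ (proj₂ (proj₂ first-divergence))
    S-diverge false = proj₁ (proj₂ (proj₂ first-divergence)) ∘ sym

    S-agree : ∀ j → j ≤ d → S true j ≡ S false j
    S-agree zero    _ = trans (S-start true) (sym (S-start false))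
    S-agree (suc j) 1+j≤d =
      decidable-stable (S true (suc j) F.≟ S false (suc j)) (proj₂ (proj₂ (proj₂ first-divergence)) j 1+j≤d)

    S-shared : ∀ γ j → j ≤ d → S γ j ≡ S true j
    S-shared true  j _   = refl
    S-shared false j j≤d = sym (S-agree j j≤d)

  opaque
    W-shift : ∀ γ o m → C (r γ ⊕ o ⊕ m) ≡ W γ (o + m)
    W-shift γ o m = cong C (⊕-assoc (r γ) o m)

    W-tail-avoids-R : ∀ γ o k → 1 ≤ o → o + k ≡ T γ → ∀ m → m < k → C (r γ ⊕ o ⊕ m) ≢ R
    W-tail-avoids-R γ o k 1≤o o+k≡T m m<k eR =
      W-avoids-R γ (o + m) (≤-trans 1≤o (m≤m+n o m)) (subst (o + m <_) o+k≡T (+-monoʳ-< o m<k))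
        (trans (sym (W-shift γ o m)) eR)

    W-tail-reaches-R : ∀ γ o k → o + k ≡ T γ → C (r γ ⊕ o ⊕ k) ≡ R
    W-tail-reaches-R γ o k o+k≡T = trans (W-shift γ o k) (subst (λ t → W γ t ≡ R) (sym o+k≡T) (W-end γ))

    -- From a shared vertex both circuits follow the same path up to R, hence have the same
    -- remaining length k, and k ≤ d since S γ (suc d) and S (not γ) (suc d) differ.
    shared-vertex-in-tail : ∀ γ o o' → 1 ≤ o → o ≤ T γ → 1 ≤ o' → o' ≤ T (not γ) → W γ o ≡ W (not γ) o' →
                            ∃ λ k → o + k ≡ T γ × o' + k ≡ T (not γ) × k ≤ d
    shared-vertex-in-tail γ o o' 1≤o o≤T 1≤o' o'≤T e
      with m≤n⇒∃[o]m+o≡n o≤T | m≤n⇒∃[o]m+o≡n o'≤T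
    ... | k , o+k≡T | k' , o'+k'≡T with <-cmp k k'
    ... | tri< k<k' _ _ =
      ⊥-elim (W-tail-avoids-R (not γ) o' k' 1≤o' o'+k'≡T k k<k'
        (trans (sym (same-path _ _ k e (W-tail-avoids-R γ o k 1≤o o+k≡T) k ≤-refl)) (W-tail-reaches-R γ o k o+k≡T)))
    ... | tri> _ _ k'<k =
      ⊥-elim (W-tail-avoids-R γ o k 1≤o o+k≡T k' k'<k
        (trans (sym (same-path _ _ k' (sym e) (W-tail-avoids-R (not γ) o' k' 1≤o' o'+k'≡T) k' ≤-refl))
          (W-tail-reaches-R (not γ) o' k' o'+k'≡T)))
    ... | tri≈ _ refl _ with k ≤? d
    ...   | yes k≤d = k , o+k≡T , o'+k'≡T , k≤d
    ...   | no k≰d with m≤n⇒∃[o]m+o≡n (≰⇒> k≰d)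
    ...     | v , 1+d+v≡k = ⊥-elim (S-diverge γ (begin
      S γ (suc d)                 ≡⟨ W≡S γ (o + v) (suc d) (tail-split o o+k≡T) ⟨
      W γ (o + v)                 ≡⟨ W-shift γ o v ⟨
      C (r γ ⊕ o ⊕ v)             ≡⟨ same-path _ _ k e (W-tail-avoids-R γ o k 1≤o o+k≡T) v v≤k ⟩
      C (r (not γ) ⊕ o' ⊕ v)      ≡⟨ W-shift (not γ) o' v ⟩
      W (not γ) (o' + v)          ≡⟨ W≡S (not γ) (o' + v) (suc d) (tail-split o' o'+k'≡T) ⟩
      S (not γ) (suc d)           ∎))
      where
      open ≡-Reasoning
      v≤k : v ≤ k
      v≤k = subst (v ≤_) 1+d+v≡k (m≤n+m v (suc d))
      tail-split : ∀ {t} a → a + k ≡ t → a + v + suc d ≡ t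
      tail-split {t} a a+k≡t = begin
        a + v + suc d   ≡⟨ +-assoc a v (suc d) ⟩
        a + (v + suc d) ≡⟨ cong (a +_) (trans (+-comm v (suc d)) 1+d+v≡k) ⟩
        a + k           ≡⟨ a+k≡t ⟩
        t               ∎

  record Located (z : ℤ) : Set where
    constructor located
    field
      circuit      : Bool
      offset       : ℕ
      offset<T     : offset < T circuit
      start-R      : C (z ⊖ offset) ≡ R
      start-branch : C (z ⊖ offset ⊕ 1) ≡ W circuit 1
      vertex       : C z ≡ W circuit offset

  opaque
    locate : ∀ z → Located z
    locate z with last-R z
    ... | t , tR , below with branch (z ⊖ t) tR
    ... | γ , t1 = located γ t t<T tR t1
                     (trans (cong C (sym (x⊖a⊕a≡x z t))) (follows-circuit γ (z ⊖ t) tR t1 t (<⇒≤ t<T)))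
      where
      t<T : t < T γ
      t<T with t <? T γ
      ... | yes t<T = t<T
      ... | no t≮T with m≤n⇒∃[o]m+o≡n (≮⇒≥ t≮T)
      ... | s , T+s≡t = ⊥-elim (below s (subst (s <_) T+s≡t (m<n+m s (s≤s z≤n)))
                          (trans (cong C z⊖s≡end) (trans (follows-circuit γ (z ⊖ t) tR t1 (T γ) ≤-refl) (W-end γ))))
        where
        z⊖s≡end : z ⊖ s ≡ z ⊖ t ⊕ T γ
        z⊖s≡end = sym (trans (cong (λ q → z ⊖ q ⊕ T γ) (sym T+s≡t)) (x⊖[a+b]⊕a≡x⊖b z (T γ) s))

    on-circuit : ∀ c → ∃ λ γ → ∃ λ t → t < T γ × W γ t ≡ c
    on-circuit c with C-onto c
    ... | z , Cz≡c with locate z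
    ... | located γ t t<T _ _ at = γ , t , t<T , trans (sym at) Cz≡c

  -- The vertices of circuit γ that it does not share with the other one are W γ 1 … W γ (priv γ).
  priv : Bool → ℕ
  priv γ = proj₁ (m≤n⇒∃[o]m+o≡n (d<T γ))

  1+d+priv≡T : ∀ γ → suc d + priv γ ≡ T γ
  1+d+priv≡T γ = proj₂ (m≤n⇒∃[o]m+o≡n (d<T γ))

  -- Every vertex lies on circuit true or is a private vertex of circuit false.
  private
    enumerate : ℕ → Fin (suc n)
    enumerate t with t <? T true
    ... | yes _ = W true t
    ... | no _  = W false (suc (t ∸ T true))

  opaque
    enumerate-shared : ∀ t → t < T true → enumerate t ≡ W true t
    enumerate-shared t t<T with t <? T true
    ... | yes _   = refl
    ... | no  t≮T = ⊥-elim (t≮T t<T)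

    enumerate-private : ∀ v → enumerate (T true + v) ≡ W false (suc v)
    enumerate-private v with T true + v <? T true
    ... | yes lt = ⊥-elim (m+n≮m (T true) v lt)
    ... | no  _  = cong (W false ∘ suc) (m+n∸m≡n (T true) v)

    ≤priv⇒<T : ∀ γ o → o ≤ priv γ → o < T γ
    ≤priv⇒<T γ o o≤priv = subst (o <_) (1+d+priv≡T γ) (s≤s (≤-trans o≤priv (m≤n+m (priv γ) d)))

    private-vertex-unshared : ∀ t v → t < T true → v < priv false → W true t ≢ W false (suc v)
    private-vertex-unshared zero v _ v<priv e =
      1+n≢0 (W≡R⇒0 false (suc v) (≤priv⇒<T false (suc v) v<priv) (trans (sym e) (W-start true)))
    private-vertex-unshared (suc t) v t<T v<priv e
      with shared-vertex-in-tail true (suc t) (suc v) (s≤s z≤n) (<⇒≤ t<T)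
                                 (s≤s z≤n) (<⇒≤ (≤priv⇒<T false (suc v) v<priv)) e
    ... | k , _ , 1+v+k≡T , k≤d = <-irrefl refl (begin-strict
      suc v + k              <⟨ s≤s (subst (v + k <_) (+-comm (priv false) d) (+-mono-<-≤ v<priv k≤d)) ⟩
      suc d + priv false     ≡⟨ 1+d+priv≡T false ⟩
      T false                ≡⟨ 1+v+k≡T ⟨
      suc v + k              ∎)
      where open ≤-Reasoning

    split-index : ∀ t → t < T true ⊎ ∃ λ v → t ≡ T true + v
    split-index t with t <? T true
    ... | yes t<T = inj₁ t<T
    ... | no  t≮T = inj₂ (_ , sym (proj₂ (m≤n⇒∃[o]m+o≡n (≮⇒≥ t≮T))))

    enumerate-injective : ∀ i j → i < T true + priv false → j < T true + priv false →
                          enumerate i ≡ enumerate j → i ≡ j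
    enumerate-injective i j i<K j<K e with split-index i | split-index j
    ... | inj₁ i<T | inj₁ j<T =
      W-injective₀ true i j i<T j<T (trans (sym (enumerate-shared i i<T)) (trans e (enumerate-shared j j<T)))
    ... | inj₁ i<T | inj₂ (v , refl) = ⊥-elim (private-vertex-unshared i v i<T (+-cancelˡ-< (T true) v _ j<K)
                                         (trans (sym (enumerate-shared i i<T)) (trans e (enumerate-private v))))
    ... | inj₂ (v , refl) | inj₁ j<T = ⊥-elim (private-vertex-unshared j v j<T (+-cancelˡ-< (T true) v _ i<K)
                                         (trans (sym (enumerate-shared j j<T)) (trans (sym e) (enumerate-private v))))
    ... | inj₂ (v , refl) | inj₂ (v' , refl) = cong (T true +_) (suc-injective
      (W-injective₁ false (suc v) (suc v') (s≤s z≤n) (s≤s z≤n)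
        (<⇒≤ (≤priv⇒<T false (suc v) (+-cancelˡ-< (T true) v _ i<K)))
        (<⇒≤ (≤priv⇒<T false (suc v') (+-cancelˡ-< (T true) v' _ j<K)))
        (trans (sym (enumerate-private v)) (trans e (enumerate-private v')))))

    past-priv-in-tail : ∀ γ t k → priv γ < t → t + k ≡ T γ → k ≤ d
    past-priv-in-tail γ t k priv<t t+k≡T = +-cancelʳ-≤ t k d (begin
      k + t              ≡⟨ trans (+-comm k t) (trans t+k≡T (sym (1+d+priv≡T γ))) ⟩
      suc d + priv γ     ≡⟨ +-suc d (priv γ) ⟨
      d + suc (priv γ)   ≤⟨ +-monoʳ-≤ d priv<t ⟩
      d + t              ∎)
      where open ≤-Reasoning

    shared-in-true : ∀ t k → t < T false → t + k ≡ T false → k ≤ d → ∃ λ q → q < T true × W true q ≡ W false t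
    shared-in-true t k t<T t+k≡T k≤d with m≤n⇒∃[o]m+o≡n (≤-trans k≤d (<⇒≤ (d<T true)))
    ... | q , k+q≡T = q , q<T , (begin
      W true q        ≡⟨ W≡S true q k (trans (+-comm q k) k+q≡T) ⟩
      S true k        ≡⟨ S-agree k k≤d ⟩
      S false k       ≡⟨ W≡S false t k t+k≡T ⟨
      W false t       ∎)
      where
      open ≡-Reasoning
      q<T : q < T true
      q<T = subst (q <_) k+q≡T (m<n+m q (a<b⇒a+u≡b⇒0<u t<T t+k≡T))

    enumerate-onto : ∀ c → ∃ λ t → t < T true + priv false × enumerate t ≡ c
    enumerate-onto c with on-circuit c
    ... | true  , t , t<T , e = t , <-≤-trans t<T (m≤m+n _ _) , trans (enumerate-shared t t<T) e
    ... | false , zero , _ , e =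
      0 , s≤s z≤n , trans (enumerate-shared 0 (s≤s z≤n)) (trans (W-start true) (trans (sym (W-start false)) e))
    ... | false , suc t , t<T , e with suc t ≤? priv false
    ...   | yes 1+t≤priv = T true + t , +-monoʳ-< (T true) 1+t≤priv , trans (enumerate-private t) e
    ...   | no  1+t≰priv with m≤n⇒∃[o]m+o≡n (<⇒≤ t<T)
    ...     | k , 1+t+k≡T
            with shared-in-true (suc t) k t<T 1+t+k≡T (past-priv-in-tail false (suc t) k (≰⇒> 1+t≰priv) 1+t+k≡T)
    ...       | q , q<T , q~t = q , <-≤-trans q<T (m≤m+n _ _) , trans (enumerate-shared q q<T) (trans q~t e)

    vertex-count : suc n ≡ T true + priv false
    vertex-count = ≤-antisym
      (FP.injective⇒≤ {f = λ c → fromℕ< (proj₁ (proj₂ (enumerate-onto c)))} λ {c} {c'} e → begin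
        c                                     ≡⟨ proj₂ (proj₂ (enumerate-onto c)) ⟨
        enumerate (proj₁ (enumerate-onto c))  ≡⟨ cong enumerate (FP.fromℕ<-injective _ _ _ _ e) ⟩
        enumerate (proj₁ (enumerate-onto c')) ≡⟨ proj₂ (proj₂ (enumerate-onto c')) ⟩
        c'                                    ∎)
      (FP.injective⇒≤ {f = enumerate ∘ toℕ} λ {i} {j} e →
        FP.toℕ-injective (enumerate-injective (toℕ i) (toℕ j) (FP.toℕ<n i) (FP.toℕ<n j) e))
      where open ≡-Reasoning

    T+priv≡1+n : ∀ γ → T γ + priv (not γ) ≡ suc n
    T+priv≡1+n true  = sym vertex-count
    T+priv≡1+n false = begin
      T false + priv true                ≡⟨ cong (_+ priv true) (1+d+priv≡T false) ⟨
      suc d + priv false + priv true     ≡⟨ +-assoc (suc d) (priv false) (priv true) ⟩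
      suc d + (priv false + priv true)   ≡⟨ cong (suc d +_) (+-comm (priv false) (priv true)) ⟩
      suc d + (priv true + priv false)   ≡⟨ +-assoc (suc d) (priv true) (priv false) ⟨
      suc d + priv true + priv false     ≡⟨ cong (_+ priv false) (1+d+priv≡T true) ⟩
      T true + priv false                ≡⟨ vertex-count ⟨
      suc n                              ∎
      where open ≡-Reasoning

  Cover : Fin (suc n) → Set
  Cover U = ∀ p → ∃ λ t → t < n × C (p ⊕ t) ≡ U

  Central : Fin (suc n) → Set
  Central U = ∃ λ j → j ≤ d × S true j ≡ U

  -- Circuit γ goes from R straight to M (an edge R → M of the graph): it has no private vertex.
  Shortcut : Bool → Set
  Shortcut γ = W γ 1 ≡ M

  opaque
    shortcut⇒priv≡0 : ∀ γ → Shortcut γ → priv γ ≡ 0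
    shortcut⇒priv≡0 γ sc = suc-injective (sym
      (W-injective₁ γ 1 (suc (priv γ)) (s≤s z≤n) (s≤s z≤n) (s≤s z≤n)
        (subst (suc (priv γ) ≤_) split (m≤m+n _ d))
        (trans sc (trans (sym (S-shared γ d ≤-refl)) (sym (W≡S γ (suc (priv γ)) d split))))))
      where
      split : suc (priv γ) + d ≡ T γ
      split = trans (cong suc (+-comm (priv γ) d)) (1+d+priv≡T γ)

    priv≡0⇒shortcut : ∀ γ → priv γ ≡ 0 → Shortcut γ
    priv≡0⇒shortcut γ priv≡0 = trans (W≡S γ 1 d split) (S-shared γ d ≤-refl)
      where
      split : suc d ≡ T γ
      split = trans (sym (+-identityʳ (suc d))) (trans (cong (suc d +_) (sym priv≡0)) (1+d+priv≡T γ))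

    ¬shortcut⇒0<priv : ∀ γ → ¬ Shortcut γ → 0 < priv γ
    ¬shortcut⇒0<priv γ ¬sc with priv γ in priv≡
    ... | zero  = ⊥-elim (¬sc (priv≡0⇒shortcut γ priv≡))
    ... | suc _ = s≤s z≤n

    ¬shortcut⇒T≤n : (∀ γ → ¬ Shortcut γ) → ∀ γ → T γ ≤ n
    ¬shortcut⇒T≤n ¬sc γ = ≤-pred (begin
      suc (T γ)           ≡⟨ +-comm 1 (T γ) ⟩
      T γ + 1             ≤⟨ +-monoʳ-≤ (T γ) (¬shortcut⇒0<priv (not γ) (¬sc (not γ))) ⟩
      T γ + priv (not γ)  ≡⟨ T+priv≡1+n γ ⟩
      suc n               ∎)
      where open ≤-Reasoning

    shortcut⇒T≡1+n : ∀ γ → Shortcut γ → T (not γ) ≡ suc n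
    shortcut⇒T≡1+n γ sc = begin
      T (not γ)                    ≡⟨ +-identityʳ _ ⟨
      T (not γ) + 0                ≡⟨ cong (T (not γ) +_) (shortcut⇒priv≡0 γ sc) ⟨
      T (not γ) + priv γ           ≡⟨ cong (λ γ' → T (not γ) + priv γ') (not-involutive γ) ⟨
      T (not γ) + priv (not (not γ)) ≡⟨ T+priv≡1+n (not γ) ⟩
      suc n                        ∎
      where open ≡-Reasoning

    S-avoids-R : ∀ j → 1 ≤ j → j ≤ d → S true j ≢ R
    S-avoids-R j 1≤j j≤d with m≤n⇒∃[o]m+o≡n (≤-trans j≤d (<⇒≤ (d<T true)))
    ... | o , j+o≡T = W-avoids-R true o (a<b⇒a+u≡b⇒0<u (≤-trans (s≤s j≤d) (d<T true)) j+o≡T)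
                        (subst (o <_) j+o≡T (m<n+m o 1≤j)) ∘ trans (W≡S true o j (trans (+-comm o j) j+o≡T))

    central-path : ∀ j → j ≤ d → ∀ x → C x ≡ S true j → ∀ k i → k + i ≡ j → C (x ⊕ k) ≡ S true i
    central-path j j≤d x e k i k+i≡j =
      trans (sym (same-path (start j) x j (sym e) avoid k (subst (k ≤_) k+i≡j (m≤m+n k i))))
        (cong C (start⊕k≡start j k i k+i≡j))
      where
      start : ℕ → ℤ
      start i = r true ⊕ T true ⊖ i

      start⊕k≡start : ∀ j k i → k + i ≡ j → start j ⊕ k ≡ start i
      start⊕k≡start j k i k+i≡j =
        trans (cong (λ l → start l ⊕ k) (sym k+i≡j)) (x⊖[a+b]⊕a≡x⊖b (r true ⊕ T true) k i)

      avoid : ∀ m → m < j → C (start j ⊕ m) ≢ R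
      avoid m m<j with m≤n⇒∃[o]m+o≡n (<⇒≤ m<j)
      ... | i' , m+i'≡j =
        S-avoids-R i' (a<b⇒a+u≡b⇒0<u m<j m+i'≡j) (≤-trans (subst (i' ≤_) m+i'≡j (m≤n+m i' m)) j≤d)
          ∘ trans (cong C (sym (start⊕k≡start j m i' m+i'≡j)))

    central⇒R-ahead : ∀ j → j ≤ d → ∀ x → C x ≡ S true j → C (x ⊕ j) ≡ R
    central⇒R-ahead j j≤d x e = trans (central-path j j≤d x e j 0 (+-identityʳ j)) (S-start true)

    private-vertex-unshared-by-other : ∀ γ o → 1 ≤ o → o ≤ priv γ →
                                       ∀ t → t < T (not γ) → W γ o ≢ W (not γ) t
    private-vertex-unshared-by-other γ o 1≤o o≤priv zero _ e =
      <-irrefl (sym (W≡R⇒0 γ o (≤priv⇒<T γ o o≤priv) (trans e (W-start (not γ))))) 1≤o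
    private-vertex-unshared-by-other γ o 1≤o o≤priv (suc t) t<T e
      with shared-vertex-in-tail γ o (suc t) 1≤o (<⇒≤ (≤priv⇒<T γ o o≤priv)) (s≤s z≤n) (<⇒≤ t<T) e
    ... | k , o+k≡T , _ , k≤d = <-irrefl refl (begin-strict
      o + k          ≤⟨ +-mono-≤ o≤priv k≤d ⟩
      priv γ + d     <⟨ s≤s (≤-reflexive (+-comm (priv γ) d)) ⟩
      suc d + priv γ ≡⟨ 1+d+priv≡T γ ⟩
      T γ            ≡⟨ o+k≡T ⟨
      o + k          ∎)
      where open ≤-Reasoning

    private-vertex-locates : ∀ γ o → 1 ≤ o → o ≤ priv γ → ∀ z → C z ≡ W γ o →
                             C (z ⊖ o) ≡ R × C (z ⊖ o ⊕ 1) ≡ W γ 1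
    private-vertex-locates γ o 1≤o o≤priv z e with locate z
    ... | located γ' t t<T tR t1 at with γ' ≟ᵇ γ
    ...   | yes refl = subst (λ q → C (z ⊖ q) ≡ R × C (z ⊖ q ⊕ 1) ≡ W γ 1)
                         (W-injective₀ γ t o t<T (≤priv⇒<T γ o o≤priv) (trans (sym at) e)) (tR , t1)
    ...   | no γ'≢γ  = ⊥-elim (private-vertex-unshared-by-other γ o 1≤o o≤priv t
                         (subst (λ γ'' → t < T γ'') (¬-not γ'≢γ) t<T)
                         (trans (sym e) (trans at (cong (λ γ'' → W γ'' t) (¬-not γ'≢γ)))))

    W-tail-central : ∀ γ j o → j ≤ d → j + o ≡ T γ → W γ o ≡ S true j
    W-tail-central γ j o j≤d j+o≡T = trans (W≡S γ o j (trans (+-comm o j) j+o≡T)) (S-shared γ j j≤d)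

    located-ahead : ∀ γ p t → C (p ⊖ t) ≡ R → C (p ⊖ t ⊕ 1) ≡ W γ 1 →
                    ∀ u o → t + u ≡ o → o ≤ T γ → C (p ⊕ u) ≡ W γ o
    located-ahead γ p t tR t1 u o t+u≡o o≤T =
      trans (cong C (sym (x⊖a⊕[a+b]≡x⊕b p t u)))
        (trans (cong (λ k → C (p ⊖ t ⊕ k)) t+u≡o) (follows-circuit γ (p ⊖ t) tR t1 o o≤T))

    -- The window at p meets U on the circuit through p or, failing that, on the next circuit.
    central⇒cover : ∀ U → Central U → (∀ γ → ¬ Shortcut γ) → Cover U
    central⇒cover _ (j , j≤d , refl) ¬sc p with locate p
    ... | located γ t t<T tR t1 _ with m≤n⇒∃[o]m+o≡n (≤-trans j≤d (<⇒≤ (d<T γ)))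
    ...   | o , j+o≡T with t ≤? o
    ...     | yes t≤o with m≤n⇒∃[o]m+o≡n t≤o
    ...       | u , t+u≡o with offset-in-window j t u o j+o≡T t+u≡o (¬shortcut⇒T≤n ¬sc γ)
    ...         | inj₁ u<n = u , u<n ,
                  trans (located-ahead γ p t tR t1 u o t+u≡o (subst (o ≤_) j+o≡T (m≤n+m o j)))
                        (W-tail-central γ j o j≤d j+o≡T)
    ...         | inj₂ (refl , refl) = 0 , <-≤-trans (s≤s z≤n) (¬shortcut⇒T≤n ¬sc γ) ,
                  trans (cong C (trans (⊕-identityʳ p) (sym (⊖-identityʳ p)))) (trans tR (sym (S-start true)))
    central⇒cover _ (j , j≤d , refl) ¬sc p | located γ t t<T tR t1 _ | o , j+o≡T | no t≰o
      with m≤n⇒∃[o]m+o≡n (<⇒≤ t<T)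
    ... | s , t+s≡T with trans (located-ahead γ p t tR t1 s (T γ) t+s≡T ≤-refl) (W-end γ)
    ... | sR with branch (p ⊕ s) sR
    ... | γ' , s1 with m≤n⇒∃[o]m+o≡n (≤-trans j≤d (<⇒≤ (d<T γ')))
    ... | o' , j+o'≡T' = s + o' , <-≤-trans (+-monoˡ-< o' s<j) (subst (_≤ n) (sym j+o'≡T') (¬shortcut⇒T≤n ¬sc γ')) ,
      trans (cong C (sym (⊕-assoc p s o')))
        (trans (follows-circuit γ' (p ⊕ s) sR s1 o' (subst (o' ≤_) j+o'≡T' (m≤n+m o' j)))
          (W-tail-central γ' j o' j≤d j+o'≡T'))
      where
      s<j : s < j
      s<j = +-cancelˡ-< t s j (begin-strict
        t + s   ≡⟨ t+s≡T ⟩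
        T γ     ≡⟨ j+o≡T ⟨
        j + o   <⟨ +-monoʳ-< j (≰⇒> t≰o) ⟩
        j + t   ≡⟨ +-comm j t ⟩
        t + j   ∎)
        where open ≤-Reasoning

    -- An occurrence of S true j is followed by R after j steps; in the window below that R would
    -- fall strictly inside circuit ¬γ, which has length n + 1 when γ is a shortcut.
    cover⇒¬shortcut : ∀ U → Cover U → Central U → ∀ γ → ¬ Shortcut γ
    cover⇒¬shortcut _ cover (j , j≤d , refl) γ sc with cover (r (not γ) ⊕ 1 ⊖ j)
    ... | t , t<n , e = W-avoids-R (not γ) (suc t) (s≤s z≤n) (subst (suc t <_) (sym (shortcut⇒T≡1+n γ sc)) (s≤s t<n))
      (trans (cong C (sym (trans (x⊖a⊕b⊕a≡x⊕b (r (not γ) ⊕ 1) j t) (⊕-assoc (r (not γ)) 1 t))))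
        (central⇒R-ahead j j≤d _ e))

    n<T+T : ∀ γ → n < T γ + T (not γ)
    n<T+T γ = subst (_≤ T γ + T (not γ)) (T+priv≡1+n γ) (+-monoʳ-≤ (T γ) (<⇒≤ (≤priv⇒<T (not γ) _ ≤-refl)))

    γ-starts-only-at-0 : ∀ γ x → C x ≡ R → C (x ⊕ 1) ≡ W γ 1 → C (x ⊕ T γ ⊕ 1) ≡ W (not γ) 1 →
                         ∀ s → 1 ≤ s → s < T γ + T (not γ) → C (x ⊕ s) ≡ R → C (x ⊕ s ⊕ 1) ≢ W γ 1
    γ-starts-only-at-0 γ x xR x1 y1 s 1≤s s<T+T sR s1 with <-cmp s (T γ)
    ... | tri< s<T _ _ = W-avoids-R γ s 1≤s s<T (trans (sym (follows-circuit γ x xR x1 s (<⇒≤ s<T))) sR)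
    ... | tri≈ _ refl _ = circuits-branch-apart γ (trans (sym s1) y1)
    ... | tri> _ _ T<s with m≤n⇒∃[o]m+o≡n (<⇒≤ T<s)
    ...   | s' , T+s'≡s = W-avoids-R (not γ) s' (a<b⇒a+u≡b⇒0<u T<s T+s'≡s) s'<T
      (trans (sym (follows-circuit (not γ) (x ⊕ T γ) yR y1 s' (<⇒≤ s'<T)))
        (trans (cong C (trans (⊕-assoc x (T γ) s') (cong (x ⊕_) T+s'≡s))) sR))
      where
      s'<T : s' < T (not γ)
      s'<T = +-cancelˡ-< (T γ) s' _ (subst (_< T γ + T (not γ)) (sym T+s'≡s) s<T+T)
      yR : C (x ⊕ T γ) ≡ R
      yR = trans (follows-circuit γ x xR x1 (T γ) ≤-refl) (W-end γ)

    -- Every occurrence of W γ o comes o steps after the start of a circuit γ, and there is no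
    -- such start strictly between x and the end of the circuit ¬γ following circuit γ at x.
    private-vertex-misses-window : ∀ γ o → 1 ≤ o → o ≤ priv γ → Cover (W γ o) →
                                   ∀ x → C x ≡ R → C (x ⊕ 1) ≡ W γ 1 → C (x ⊕ T γ ⊕ 1) ≢ W (not γ) 1
    private-vertex-misses-window γ o 1≤o o≤priv cover x xR x1 y1 with cover (x ⊕ suc o)
    ... | t , t<n , e with private-vertex-locates γ o 1≤o o≤priv (x ⊕ suc o ⊕ t) e
    ... | zR , z1 = γ-starts-only-at-0 γ x xR x1 y1 (suc t) (s≤s z≤n) (<-≤-trans (s≤s t<n) (n<T+T γ))
                      (subst (λ q → C q ≡ R) start≡ zR) (subst (λ q → C (q ⊕ 1) ≡ W γ 1) start≡ z1)
      where
      start≡ : x ⊕ suc o ⊕ t ⊖ o ≡ x ⊕ suc t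
      start≡ = trans (cong (_⊖ o) (trans (⊕-assoc x (suc o) t) (cong (x ⊕_) (sym (+-suc o t)))))
                 (x⊕[a+b]⊖a≡x⊕b x o (suc t))

    -- Otherwise w is periodic with period T γ from r γ on.
    circuit-switches : ∀ γ → ¬ (∀ x → C x ≡ R → C (x ⊕ 1) ≡ W γ 1 → C (x ⊕ T γ ⊕ 1) ≢ W (not γ) 1)
    circuit-switches γ repeats = aperiodic (r γ) (T γ) (s≤s z≤n) periodic
      where
      StartsCircuit : ℤ → Set
      StartsCircuit x = C x ≡ R × C (x ⊕ 1) ≡ W γ 1

      again : ∀ x → StartsCircuit x → StartsCircuit (x ⊕ T γ)
      again x (xR , x1) with trans (follows-circuit γ x xR x1 (T γ) ≤-refl) (W-end γ)
      ... | yR with branch (x ⊕ T γ) yR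
      ... | γ' , y1 with γ' ≟ᵇ γ
      ... | yes refl  = yR , y1
      ... | no γ'≢γ   = ⊥-elim (repeats x xR x1 (trans y1 (cong (λ γ'' → W γ'' 1) (¬-not γ'≢γ))))

      starts : ∀ k → StartsCircuit (r γ ⊕ k * T γ)
      starts zero    = subst StartsCircuit (sym (⊕-identityʳ (r γ))) (r-R γ , refl)
      starts (suc k) = subst StartsCircuit
                         (trans (⊕-assoc (r γ) (k * T γ) (T γ)) (cong (r γ ⊕_) (+-comm (k * T γ) (T γ))))
                         (again _ (starts k))

      at : ∀ m → C (r γ ⊕ m) ≡ W γ (m % T γ)
      at m = trans (cong C (trans (cong (r γ ⊕_) m≡) (sym (⊕-assoc (r γ) (m / T γ * T γ) (m % T γ)))))
               (follows-circuit γ _ (proj₁ (starts (m / T γ))) (proj₂ (starts (m / T γ)))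
                  (m % T γ) (<⇒≤ (m%n<n m (T γ))))
        where
        m≡ : m ≡ m / T γ * T γ + m % T γ
        m≡ = trans (m≡m%n+[m/n]*n m (T γ)) (+-comm (m % T γ) (m / T γ * T γ))

      periodic : ∀ m → C (r γ ⊕ (m + T γ)) ≡ C (r γ ⊕ m)
      periodic m = trans (at (m + T γ)) (trans (cong (W γ) ([m+n]%n≡m%n m (T γ))) (sym (at m)))

    cover⇒central : ∀ U → Cover U → Central U
    cover⇒central U cover with on-circuit U
    ... | γ , zero , _ , refl = 0 , z≤n , trans (S-start true) (sym (W-start γ))
    ... | γ , suc o , o<T , refl with suc o ≤? priv γ
    ...   | yes o≤priv = ⊥-elim (circuit-switches γ (private-vertex-misses-window γ (suc o) (s≤s z≤n) o≤priv cover))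
    ...   | no  o≰priv with m≤n⇒∃[o]m+o≡n (<⇒≤ o<T)
    ...     | k , 1+o+k≡T = k , k≤d , sym (W-tail-central γ k (suc o) k≤d (trans (+-comm k (suc o)) 1+o+k≡T))
      where
      k≤d : k ≤ d
      k≤d = past-priv-in-tail γ (suc o) k (≰⇒> o≰priv) 1+o+k≡T

    M-to-R : ∀ x → C x ≡ M → ∀ e → C (x ⊕ e) ≡ R → d ≤ e
    M-to-R x xM e eR with d ≤? e
    ... | yes d≤e = d≤e
    ... | no  d≰e with m≤n⇒∃[o]m+o≡n (<⇒≤ (≰⇒> d≰e))
    ... | j , e+j≡d = ⊥-elim (S-avoids-R j (a<b⇒a+u≡b⇒0<u (≰⇒> d≰e) e+j≡d) (subst (j ≤_) e+j≡d (m≤n+m j e))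
                        (trans (sym (central-path d ≤-refl x xM e j e+j≡d)) eR))

    R⇒M-behind : ∀ x → C x ≡ R → C (x ⊖ d) ≡ M
    R⇒M-behind x xR with locate (x ⊖ 1)
    ... | located γ t t<T tR t1 _ with m≤n⇒∃[o]m+o≡n (≤-trans (n≤1+n d) (d<T γ))
    ... | o , d+o≡T =
      trans (cong C x⊖d≡) (trans (follows-circuit γ (x ⊖ 1 ⊖ t) tR t1 o (subst (o ≤_) d+o≡T (m≤n+m o d)))
                                 (W-tail-central γ d o ≤-refl d+o≡T))
      where
      back : x ⊖ 1 ⊖ t ⊕ suc t ≡ x
      back = trans (cong (_⊕ suc t) (x⊖a⊖b≡x⊖[a+b] x 1 t)) (x⊖a⊕a≡x x (suc t))

      1+t≡T : suc t ≡ T γ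
      1+t≡T with m≤n⇒m<n∨m≡n t<T
      ... | inj₁ 1+t<T = ⊥-elim (W-avoids-R γ (suc t) (s≤s z≤n) 1+t<T
                            (trans (sym (follows-circuit γ _ tR t1 (suc t) t<T)) (trans (cong C back) xR)))
      ... | inj₂ 1+t≡T = 1+t≡T

      x⊖d≡ : x ⊖ d ≡ x ⊖ 1 ⊖ t ⊕ o
      x⊖d≡ = sym (trans (cong (_⊕ o) (trans (x⊖a⊖b≡x⊖[a+b] x 1 t)
                                          (cong (x ⊖_) (trans 1+t≡T (trans (sym d+o≡T) (+-comm d o))))))
                   (x⊖[a+b]⊕a≡x⊖b x o d))

  pre-M : Bool → ℤ
  pre-M γ = r γ ⊕ T γ ⊖ suc d

  opaque
    pre-M-next : ∀ γ → C (pre-M γ ⊕ 1) ≡ M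
    pre-M-next γ = trans (cong C (x⊖[a+b]⊕a≡x⊖b (r γ ⊕ T γ) 1 d)) (S-shared γ d ≤-refl)

    pre-M-differ : C (pre-M true) ≢ C (pre-M false)
    pre-M-differ = S-diverge true

module Factors {A : Set} (w : BiWord A) where

  factor : ℤ → ℕ → List A
  factor x zero    = []
  factor x (suc m) = w x ∷ factor (x ⊕ 1) m

  length-factor : ∀ x m → length (factor x m) ≡ m
  length-factor x zero    = refl
  length-factor x (suc m) = cong suc (length-factor (x ⊕ 1) m)

  factor-occurs : ∀ x m → OccursAt w (factor x m) x
  factor-occurs x (suc m) F.zero    = cong w (⊕-identityʳ x)
  factor-occurs x (suc m) (F.suc k) = trans (cong w (sym (⊕-assoc x 1 (toℕ k)))) (factor-occurs (x ⊕ 1) m k)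

  occurs⇒≡factor : ∀ u x → OccursAt w u x → u ≡ factor x (length u)
  occurs⇒≡factor []      x occ = refl
  occurs⇒≡factor (a ∷ u) x occ =
    cong₂ _∷_ (trans (sym (occ F.zero)) (cong w (⊕-identityʳ x)))
              (occurs⇒≡factor u (x ⊕ 1) (λ k → trans (cong w (⊕-assoc x 1 (toℕ k))) (occ (F.suc k))))

  ≡factor⇒occurs : ∀ u x → u ≡ factor x (length u) → OccursAt w u x
  ≡factor⇒occurs u x u≡ = subst (λ v → OccursAt w v x) (sym u≡) (factor-occurs x (length u))

  factor-∷ʳ : ∀ x m → factor x (suc m) ≡ factor x m ++ [ w (x ⊕ m) ]
  factor-∷ʳ x zero    = cong (λ y → w y ∷ []) (sym (⊕-identityʳ x))
  factor-∷ʳ x (suc m) =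
    cong (w x ∷_) (trans (factor-∷ʳ (x ⊕ 1) m) (cong (λ y → factor (x ⊕ 1) m ++ [ w y ]) (⊕-assoc x 1 m)))

  occurs-∷ : ∀ a u y → OccursAt w (a ∷ u) y → w y ≡ a × OccursAt w u (y ⊕ 1)
  occurs-∷ a u y occ = sym (proj₁ (∷-injective eq)) , ≡factor⇒occurs u (y ⊕ 1) (proj₂ (∷-injective eq))
    where
    eq : a ∷ u ≡ w y ∷ factor (y ⊕ 1) (length u)
    eq = occurs⇒≡factor (a ∷ u) y occ

  occurs-∷ʳ : ∀ a u y → OccursAt w (u ++ [ a ]) y → OccursAt w u y × w (y ⊕ length u) ≡ a
  occurs-∷ʳ a u y occ = ≡factor⇒occurs u y (proj₁ split) , sym (proj₂ split)
    where
    eq : u ++ [ a ] ≡ factor y (length u) ++ [ w (y ⊕ length u) ]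
    eq = trans (occurs⇒≡factor (u ++ [ a ]) y occ)
           (trans (cong (factor y) (trans (length-++ u) (+-comm (length u) 1))) (factor-∷ʳ y (length u)))
    split : u ≡ factor y (length u) × a ≡ w (y ⊕ length u)
    split = ∷ʳ-injective u (factor y (length u)) eq

  factor-infix : ∀ x k m L → k + m ≤ L → Infix _≡_ (factor (x ⊕ k) m) (factor x L)
  factor-infix x zero    m L       m≤L =
    here (subst (λ y → Prefix _≡_ (factor y m) (factor x L)) (sym (⊕-identityʳ x)) (prefix x m L m≤L))
    where
    prefix : ∀ x m L → m ≤ L → Prefix _≡_ (factor x m) (factor x L)
    prefix x zero    L       _         = []
    prefix x (suc m) (suc L) (s≤s m≤L) = refl ∷ prefix (x ⊕ 1) m L m≤L
  factor-infix x (suc k) m (suc L) (s≤s k+m≤L) =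
    there (subst (λ y → Infix _≡_ (factor y m) (factor (x ⊕ 1) L)) (⊕-assoc x 1 k) (factor-infix (x ⊕ 1) k m L k+m≤L))

  prefix-factor : ∀ u x L → Prefix _≡_ u (factor x L) → length u ≤ L × u ≡ factor x (length u)
  prefix-factor []      x L       []      = z≤n , refl
  prefix-factor (a ∷ u) x (suc L) (e ∷ p) with prefix-factor u (x ⊕ 1) L p
  ... | |u|≤L , u≡ = s≤s |u|≤L , cong₂ _∷_ e u≡

  private
    prefix-at-0 : ∀ u x L → Prefix _≡_ u (factor x L) → ∃ λ k → k + length u ≤ L × u ≡ factor (x ⊕ k) (length u)
    prefix-at-0 u x L p with prefix-factor u x L p
    ... | |u|≤L , u≡ = 0 , |u|≤L , trans u≡ (cong (λ y → factor y (length u)) (sym (⊕-identityʳ x)))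

  infix-factor : ∀ u x L → Infix _≡_ u (factor x L) → ∃ λ k → k + length u ≤ L × u ≡ factor (x ⊕ k) (length u)
  infix-factor u x zero    (here p) = prefix-at-0 u x zero p
  infix-factor u x (suc L) (here p) = prefix-at-0 u x (suc L) p
  infix-factor u x (suc L) (there i) with infix-factor u (x ⊕ 1) L i
  ... | k , k+|u|≤L , u≡ = suc k , s≤s k+|u|≤L , trans u≡ (cong (λ y → factor y (length u)) (⊕-assoc x 1 k))

  record Agree (m : ℕ) (x y : ℤ) : Set where
    constructor agree
    field at : ∀ k → k < m → w (x ⊕ k) ≡ w (y ⊕ k)
  open Agree public

  agree-head : ∀ {m x y} → Agree (suc m) x y → w x ≡ w y
  agree-head {x = x} {y} ag = trans (cong w (sym (⊕-identityʳ x))) (trans (at ag 0 (s≤s z≤n)) (cong w (⊕-identityʳ y)))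

  agree-tail : ∀ {m x y} → Agree (suc m) x y → Agree m (x ⊕ 1) (y ⊕ 1)
  agree-tail {x = x} {y} ag = agree λ k k<m →
    trans (cong w (⊕-assoc x 1 k)) (trans (at ag (suc k) (s≤s k<m)) (cong w (sym (⊕-assoc y 1 k))))

  agree-∷ : ∀ {m x y} → w x ≡ w y → Agree m (x ⊕ 1) (y ⊕ 1) → Agree (suc m) x y
  agree-∷ {x = x} {y} wx≡wy ag = agree λ where
    zero    _         → trans (cong w (⊕-identityʳ x)) (trans wx≡wy (cong w (sym (⊕-identityʳ y))))
    (suc k) (s≤s k<m) → trans (cong w (sym (⊕-assoc x 1 k))) (trans (at ag k k<m) (cong w (⊕-assoc y 1 k)))

  agree-last : ∀ {m x y} → Agree (suc m) x y → w (x ⊕ m) ≡ w (y ⊕ m)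
  agree-last {m} ag = at ag m ≤-refl

  agree-∷ʳ : ∀ {m x y} → Agree m x y → w (x ⊕ m) ≡ w (y ⊕ m) → Agree (suc m) x y
  agree-∷ʳ ag last = agree λ k k<1+m → case m≤n⇒m<n∨m≡n (≤-pred k<1+m) of λ where
    (inj₁ k<m)  → at ag k k<m
    (inj₂ refl) → last

  agree-≤ : ∀ {m m' x y} → m ≤ m' → Agree m' x y → Agree m x y
  agree-≤ m≤m' ag = agree λ k k<m → at ag k (<-≤-trans k<m m≤m')

  agree-drop : ∀ {m x y} j → Agree (j + m) x y → Agree m (x ⊕ j) (y ⊕ j)
  agree-drop {x = x} {y} j ag = agree λ k k<m →
    trans (cong w (⊕-assoc x j k)) (trans (at ag (j + k) (+-monoʳ-< j k<m)) (cong w (sym (⊕-assoc y j k))))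

  agree-join : ∀ m d x y → (∀ k → k ≤ d → Agree (suc m) (x ⊕ k) (y ⊕ k)) → Agree (suc m + d) x y
  agree-join m d x y windows = agree pointwise
    where
    pointwise : ∀ k → k < suc m + d → w (x ⊕ k) ≡ w (y ⊕ k)
    pointwise k k<1+m+d with k ≤? d
    ... | yes k≤d = trans (cong w (sym (⊕-identityʳ (x ⊕ k))))
                      (trans (at (windows k k≤d) 0 (s≤s z≤n)) (cong w (⊕-identityʳ (y ⊕ k))))
    ... | no  k≰d with m≤n⇒∃[o]m+o≡n (<⇒≤ (≰⇒> k≰d))
    ... | u , d+u≡k = trans (cong w (sym (via x))) (trans (at (windows d ≤-refl) u u<1+m) (cong w (via y)))
      where
      via : ∀ z → z ⊕ d ⊕ u ≡ z ⊕ k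
      via z = trans (⊕-assoc z d u) (cong (z ⊕_) d+u≡k)
      u<1+m : u < suc m
      u<1+m = +-cancelˡ-< d u (suc m) (subst₂ _<_ (sym d+u≡k) (+-comm (suc m) d) k<1+m+d)

  factor≡⇒agree : ∀ m x y → factor x m ≡ factor y m → Agree m x y
  factor≡⇒agree zero    x y _ = agree λ _ ()
  factor≡⇒agree (suc m) x y e =
    agree-∷ (proj₁ (∷-injective e)) (factor≡⇒agree m (x ⊕ 1) (y ⊕ 1) (proj₂ (∷-injective e)))

  agree⇒factor≡ : ∀ m x y → Agree m x y → factor x m ≡ factor y m
  agree⇒factor≡ zero    x y _  = refl
  agree⇒factor≡ (suc m) x y ag = cong₂ _∷_ (agree-head ag) (agree⇒factor≡ m (x ⊕ 1) (y ⊕ 1) (agree-tail ag))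

  -- cls m x : Fin (suc m) is the position of factor x m in the list of the m + 1 factors of length m.
  module Classes (complexity : ∀ m → HasCount (FactorOfLength w m) (suc m)) where

    private
      factors : ℕ → List (List A)
      factors m = proj₁ (complexity m)

      length-factors : ∀ m → length (factors m) ≡ suc m
      length-factors m = proj₁ (proj₂ (complexity m))

      factors-unique : ∀ m → Unique (factors m)
      factors-unique m = proj₁ (proj₂ (proj₂ (complexity m)))

      factors-sound : ∀ m → All (FactorOfLength w m) (factors m)
      factors-sound m = proj₁ (proj₂ (proj₂ (proj₂ (complexity m))))

      factor∈factors : ∀ m x → factor x m ∈ factors m
      factor∈factors m x =
        proj₂ (proj₂ (proj₂ (proj₂ (complexity m)))) (factor x m) (length-factor x m , x , factor-occurs x m)

      lookup-injective : ∀ {xs : List (List A)} → Unique xs → ∀ i j → lookup xs i ≡ lookup xs j → i ≡ j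
      lookup-injective (_ ∷ _)  F.zero    F.zero    _ = refl
      lookup-injective (x∉ ∷ _) F.zero    (F.suc j) e = ⊥-elim (All.lookup x∉ (∈-lookup j) e)
      lookup-injective (x∉ ∷ _) (F.suc i) F.zero    e = ⊥-elim (All.lookup x∉ (∈-lookup i) (sym e))
      lookup-injective (_ ∷ u)  (F.suc i) (F.suc j) e = cong F.suc (lookup-injective u i j e)

      cast-injective : ∀ {a b} (e : a ≡ b) {i j : Fin a} → F.cast e i ≡ F.cast e j → i ≡ j
      cast-injective e {i} {j} h = FP.toℕ-injective (trans (sym (FP.toℕ-cast e i)) (trans (cong toℕ h) (FP.toℕ-cast e j)))

      index : ∀ m x → Fin (length (factors m))
      index m x = Any.index (factor∈factors m x)

    opaque
      cls : ∀ m → ℤ → Fin (suc m)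
      cls m x = F.cast (length-factors m) (index m x)

      cls≡⇒factor≡ : ∀ m x y → cls m x ≡ cls m y → factor x m ≡ factor y m
      cls≡⇒factor≡ m x y e = trans (lookup-index (factor∈factors m x))
        (trans (cong (lookup (factors m)) (cast-injective (length-factors m) e)) (sym (lookup-index (factor∈factors m y))))

      factor≡⇒cls≡ : ∀ m x y → factor x m ≡ factor y m → cls m x ≡ cls m y
      factor≡⇒cls≡ m x y e = cong (F.cast (length-factors m)) (lookup-injective (factors-unique m) _ _
        (trans (sym (lookup-index (factor∈factors m x))) (trans e (lookup-index (factor∈factors m y)))))

      cls-onto : ∀ m (c : Fin (suc m)) → ∃ λ x → cls m x ≡ c
      cls-onto m c = x , FP.toℕ-injective
        (trans (FP.toℕ-cast (length-factors m) _) (trans (cong toℕ index≡i) (FP.toℕ-cast (sym (length-factors m)) c)))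
        where
        i : Fin (length (factors m))
        i = F.cast (sym (length-factors m)) c
        i-sound : FactorOfLength w m (lookup (factors m) i)
        i-sound = All.lookup (factors-sound m) (∈-lookup i)
        x : ℤ
        x = proj₁ (proj₂ i-sound)
        index≡i : index m x ≡ i
        index≡i = lookup-injective (factors-unique m) _ _ (trans (sym (lookup-index (factor∈factors m x)))
          (sym (trans (occurs⇒≡factor _ x (proj₂ (proj₂ i-sound))) (cong (factor x) (proj₁ i-sound)))))

    cls≡⇒agree : ∀ m x y → cls m x ≡ cls m y → Agree m x y
    cls≡⇒agree m x y = factor≡⇒agree m x y ∘ cls≡⇒factor≡ m x y

    agree⇒cls≡ : ∀ m x y → Agree m x y → cls m x ≡ cls m y
    agree⇒cls≡ m x y = factor≡⇒cls≡ m x y ∘ agree⇒factor≡ m x y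

    cls₁≡⇒letter≡ : ∀ x y → cls 1 x ≡ cls 1 y → w x ≡ w y
    cls₁≡⇒letter≡ x y = agree-head ∘ cls≡⇒agree 1 x y

    letter≡⇒cls₁≡ : ∀ x y → w x ≡ w y → cls 1 x ≡ cls 1 y
    letter≡⇒cls₁≡ x y e = agree⇒cls≡ 1 x y (agree-∷ e (agree λ _ ()))

module SturmianWord {A : Set} (w : BiWord A) (sturmian : Sturmian w) where
  open Factors w
  open Classes (proj₂ sturmian)

  next : ℕ → ℤ → Fin 2
  next m x = cls 1 (x ⊕ m)

  prev : ℤ → Fin 2
  prev x = cls 1 x

  cls⁻¹ : ∀ m → Fin (suc m) → ℤ
  cls⁻¹ m c = proj₁ (cls-onto m c)

  cls∘cls⁻¹ : ∀ m c → cls m (cls⁻¹ m c) ≡ c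
  cls∘cls⁻¹ m c = proj₂ (cls-onto m c)

  cls-init : ∀ m x y → cls (suc m) x ≡ cls (suc m) y → cls m x ≡ cls m y
  cls-init m x y e = agree⇒cls≡ m x y (agree-≤ (n≤1+n m) (cls≡⇒agree (suc m) x y e))

  cls-tail : ∀ m x y → cls (suc m) x ≡ cls (suc m) y → cls m (x ⊕ 1) ≡ cls m (y ⊕ 1)
  cls-tail m x y e = agree⇒cls≡ m _ _ (agree-tail (cls≡⇒agree (suc m) x y e))

  cls-∷ʳ : ∀ m x y → cls m x ≡ cls m y → next m x ≡ next m y → cls (suc m) x ≡ cls (suc m) y
  cls-∷ʳ m x y e e' = agree⇒cls≡ (suc m) x y (agree-∷ʳ (cls≡⇒agree m x y e) (cls₁≡⇒letter≡ _ _ e'))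

  module RightSpecialClass (m : ℕ) = SpecialClass m (cls m) (cls (suc m)) (next m) (cls-init m)
    (λ x y e → letter≡⇒cls₁≡ _ _ (agree-last (cls≡⇒agree (suc m) x y e))) (cls-∷ʳ m)
    (cls⁻¹ m) (cls∘cls⁻¹ m) (cls⁻¹ (suc m)) (cls∘cls⁻¹ (suc m))

  module LeftSpecialClass (m : ℕ) = SpecialClass m (λ x → cls m (x ⊕ 1)) (cls (suc m)) prev (cls-tail m)
    (λ x y e → letter≡⇒cls₁≡ x y (agree-head (cls≡⇒agree (suc m) x y e)))
    (λ x y e e' → agree⇒cls≡ (suc m) x y (agree-∷ (cls₁≡⇒letter≡ x y e') (cls≡⇒agree m _ _ e)))
    (λ c → cls⁻¹ m c ⊖ 1) (λ c → trans (cong (cls m) (x⊖a⊕a≡x _ 1)) (cls∘cls⁻¹ m c))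
    (cls⁻¹ (suc m)) (cls∘cls⁻¹ (suc m))

  module Graph (n′ : ℕ) where

    n : ℕ
    n = suc n′

    private
      special : ∃ λ x → ∃ λ y → RightSpecialClass.Special n x y
      special = RightSpecialClass.special-exists n

    q : Bool → ℤ
    q true  = proj₁ special
    q false = proj₁ (proj₂ special)

    q-special : RightSpecialClass.Special n (q true) (q false)
    q-special = proj₂ (proj₂ special)

    R : Fin (suc n)
    R = cls n (q true)

    opaque
      q-R : ∀ γ → cls n (q γ) ≡ R
      q-R true  = refl
      q-R false = sym (proj₁ q-special)

      q-letters-differ : w (q true ⊕ n) ≢ w (q false ⊕ n)
      q-letters-differ = proj₂ q-special ∘ letter≡⇒cls₁≡ _ _

      deterministic : ∀ x y → cls n x ≡ cls n y → cls n x ≢ R → cls n (x ⊕ 1) ≡ cls n (y ⊕ 1)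
      deterministic x y e ¬R with next n x F.≟ next n y
      ... | yes e' = cls-tail n x y (cls-∷ʳ n x y e e')
      ... | no  ne = ⊥-elim (¬R (RightSpecialClass.special-unique n (e , ne) q-special))

      aperiodic : ∀ x p → 1 ≤ p → ¬ (∀ m → cls n (x ⊕ (m + p)) ≡ cls n (x ⊕ m))
      aperiodic x p 1≤p per = proj₁ sturmian (p , 1≤p , x , periodic)
        where
        periodic : (i : ℤ) → x ℤ.≤ i → w (i ⊕ p) ≡ w i
        periodic i x≤i with ⊕-or-⊖suc x i
        ... | inj₁ (m , refl) = trans (cong w (⊕-assoc x m p)) (agree-head (cls≡⇒agree n _ _ (per m)))
        ... | inj₂ (m , refl) = ⊥-elim (ℤP.<-irrefl refl (ℤP.≤-<-trans x≤i (x⊖1+a<x x m)))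

      branches-differ : cls n (q true ⊕ 1) ≢ cls n (q false ⊕ 1)
      branches-differ e = q-letters-differ
        (trans (cong w (sym (⊕-assoc (q true) 1 n′)))
          (trans (agree-last (cls≡⇒agree n _ _ e)) (cong w (⊕-assoc (q false) 1 n′))))

      branch : ∀ x → cls n x ≡ R → ∃ λ γ → cls n (x ⊕ 1) ≡ cls n (q γ ⊕ 1)
      branch x xR with fin2-≢⇒≡⊎≡ (next n (q true)) (next n (q false)) (next n x) (proj₂ q-special)
      ... | inj₁ e = true  , cls-tail n x (q true) (cls-∷ʳ n x (q true) xR e)
      ... | inj₂ e = false , cls-tail n x (q false) (cls-∷ʳ n x (q false) (trans xR (proj₁ q-special)) e)

    open Circuits n (cls n) R deterministic aperiodic q q-R branches-differ branch (cls-onto n) public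

    -- Position p ⊕ n′ lies in an occurrence of u exactly when u starts in the window p … p ⊕ n′.
    quasiperiod⇒cover : ∀ u → QuasiperiodOfLength w n u → ∃ λ x → u ≡ factor x n × Cover (cls n x)
    quasiperiod⇒cover u (|u|≡n , qp) = x₀ , u≡ x₀ (proj₁ (proj₂ (qp (ℤ.+ 0)))) , cover
      where
      x₀ : ℤ
      x₀ = proj₁ (qp (ℤ.+ 0))

      u≡ : ∀ x → OccursAt w u x → u ≡ factor x n
      u≡ x occ = trans (occurs⇒≡factor u x occ) (cong (factor x) |u|≡n)

      cover : Cover (cls n x₀)
      cover p with qp (p ⊕ n′)
      ... | i , occ , i≤ , <i+|u| with ⊕-or-⊖suc p i
      ... | inj₁ (t , refl) = t , s≤s (⊕-cancelˡ-≤ p t n′ i≤) ,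
                              factor≡⇒cls≡ n _ _ (trans (sym (u≡ _ occ)) (u≡ x₀ (proj₁ (proj₂ (qp (ℤ.+ 0))))))
      ... | inj₂ (m , refl) = ⊥-elim (ℤP.<-irrefl refl (ℤP.<-≤-trans <i+n (x⊖a≤x (p ⊕ n′) m)))
        where
        <i+n : p ⊕ n′ ℤ.< p ⊕ n′ ⊖ m
        <i+n = subst (p ⊕ n′ ℤ.<_) (trans (cong (p ⊖ suc m ⊕_) |u|≡n) (x⊖1+a⊕1+b≡x⊕b⊖a p m n′)) <i+|u|

    cover⇒quasiperiod : ∀ x → Cover (cls n x) → QuasiperiodOfLength w n (factor x n)
    cover⇒quasiperiod x cover = length-factor x n , covering
      where
      covering : Quasiperiod w (factor x n)
      covering p with cover (p ⊖ n′)
      ... | t , t<n , e with m≤n⇒∃[o]m+o≡n (≤-pred t<n)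
      ... | v , t+v≡n′ = p ⊖ n′ ⊕ t , occ , subst (p ⊖ n′ ⊕ t ℤ.≤_) i⊕v≡p (x≤x⊕a _ v) ,
                         subst (p ℤ.<_)
                           (sym (trans (cong (p ⊖ n′ ⊕ t ⊕_) (length-factor x n)) (x⊖b⊕a⊕1+b≡x⊕1+a p t n′)))
                           (x<x⊕1+a p t)
        where
        occ : OccursAt w (factor x n) (p ⊖ n′ ⊕ t)
        occ = subst (λ u → OccursAt w u (p ⊖ n′ ⊕ t)) (cls≡⇒factor≡ n _ x e) (factor-occurs _ n)
        i⊕v≡p : p ⊖ n′ ⊕ t ⊕ v ≡ p
        i⊕v≡p = trans (⊕-assoc (p ⊖ n′) t v) (trans (cong (p ⊖ n′ ⊕_) t+v≡n′) (x⊖a⊕a≡x p n′))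

    shortcut⇒no-quasiperiod : ∀ γ → Shortcut γ → ∀ u → ¬ QuasiperiodOfLength w n u
    shortcut⇒no-quasiperiod γ sc u qp with quasiperiod⇒cover u qp
    ... | _ , _ , cover = cover⇒¬shortcut _ cover (cover⇒central _ cover) γ sc

    central⇒quasiperiod : (∀ γ → ¬ Shortcut γ) → ∀ x → Central (cls n x) → QuasiperiodOfLength w n (factor x n)
    central⇒quasiperiod ¬sc x c = cover⇒quasiperiod x (central⇒cover _ c ¬sc)

    opaque
      pre-M-letters-differ : w (pre-M true) ≢ w (pre-M false)
      pre-M-letters-differ e = pre-M-differ (agree⇒cls≡ n _ _ (agree-∷ e
        (agree-≤ (n≤1+n n′) (cls≡⇒agree n _ _ (trans (pre-M-next true) (sym (pre-M-next false)))))))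

      M-agree : ∀ x y → cls n x ≡ M → cls n y ≡ M → Agree (n + d) x y
      M-agree x y xM yM = agree-join n′ d x y λ k k≤d →
        cls≡⇒agree n _ _ (trans (path x xM k k≤d) (sym (path y yM k k≤d)))
        where
        path : ∀ z → cls n z ≡ M → ∀ k → k ≤ d → cls n (z ⊕ k) ≡ S true (d ∸ k)
        path z zM k k≤d = central-path d ≤-refl z zM k (d ∸ k) (m+[n∸m]≡n k≤d)

      after-M-left-special : ∀ x m → m ≤ n + d → cls n x ≡ M → LeftSpecial w (factor x m)
      after-M-left-special x m m≤n+d xM =
        w (pre-M true) , w (pre-M false) , pre-M-letters-differ , (pre-M true , occurs true) , (pre-M false , occurs false)
        where
        occurs : ∀ γ → OccursAt w (w (pre-M γ) ∷ factor x m) (pre-M γ)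
        occurs γ = subst (λ v → OccursAt w (w (pre-M γ) ∷ v) (pre-M γ))
                     (agree⇒factor≡ m _ _ (agree-≤ m≤n+d (M-agree _ x (pre-M-next γ) xM)))
                     (factor-occurs (pre-M γ) (suc m))

      shortcut⇒bispecial : ∀ γ → Shortcut γ → 1 ≤ n′ →
                           ∃ λ b → Bispecial w b × length b ≡ n ∸ 1 × 0 < length b
      shortcut⇒bispecial γ sc 1≤n′ =
        b , ((q γ ⊕ 1 , factor-occurs _ n′) ,
             after-M-left-special (q γ ⊕ 1) n′ (≤-trans (n≤1+n n′) (m≤m+n n d)) sc ,
             right-special) ,
        length-factor _ n′ , subst (0 <_) (sym (length-factor _ n′)) 1≤n′
        where
        b : List A
        b = factor (q γ ⊕ 1) n′

        occurs : ∀ γ' → OccursAt w (b ++ [ w (q γ' ⊕ n) ]) (q γ' ⊕ 1)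
        occurs γ' = subst (λ v → OccursAt w v (q γ' ⊕ 1))
                      (trans (factor-∷ʳ (q γ' ⊕ 1) n′)
                        (cong₂ (λ v a → v ++ [ a ])
                          (agree⇒factor≡ n′ _ _ (agree-tail (cls≡⇒agree n _ _ (trans (q-R γ') (sym (q-R γ))))))
                          (cong w (⊕-assoc (q γ') 1 n′))))
                      (factor-occurs (q γ' ⊕ 1) n)

        right-special : RightSpecial w b
        right-special = w (q true ⊕ n) , w (q false ⊕ n) , q-letters-differ ,
                        (q true ⊕ 1 , occurs true) , (q false ⊕ 1 , occurs false)

      right-special-class : ∀ k m → k + m ≡ n → ∀ x₁ x₂ → Agree m x₁ x₂ → w (x₁ ⊕ m) ≢ w (x₂ ⊕ m) →
                            cls m x₁ ≡ cls m (q true ⊕ k)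
      right-special-class k m k+m≡n x₁ x₂ ag differ =
        RightSpecialClass.special-unique m (agree⇒cls≡ m _ _ ag , differ ∘ cls₁≡⇒letter≡ _ _)
          (agree⇒cls≡ m _ _ (agree-drop k
             (subst (λ l → Agree l (q true) (q false)) (sym k+m≡n) (cls≡⇒agree n _ _ (proj₁ q-special)))) ,
           λ e → q-letters-differ (trans (cong w (at-n true)) (trans (cls₁≡⇒letter≡ _ _ e) (cong w (sym (at-n false))))))
        where
        at-n : ∀ γ → q γ ⊕ n ≡ q γ ⊕ k ⊕ m
        at-n γ = trans (cong (q γ ⊕_) (sym k+m≡n)) (sym (⊕-assoc (q γ) k m))

      left-special-class : ∀ m → m ≤ n → ∀ y₁ y₂ → Agree m (y₁ ⊕ 1) (y₂ ⊕ 1) → w y₁ ≢ w y₂ →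
                           cls m (y₁ ⊕ 1) ≡ cls m (pre-M true ⊕ 1)
      left-special-class m m≤n y₁ y₂ ag differ =
        LeftSpecialClass.special-unique m (agree⇒cls≡ m _ _ ag , differ ∘ cls₁≡⇒letter≡ _ _)
          (agree⇒cls≡ m _ _ (agree-≤ m≤n (cls≡⇒agree n _ _ (trans (pre-M-next true) (sym (pre-M-next false))))) ,
           pre-M-letters-differ ∘ cls₁≡⇒letter≡ _ _)

      q-continues-into-M : ∀ γ → cls n′ (q γ ⊕ 1) ≡ cls n′ (pre-M true ⊕ 1) →
                           cls 1 (pre-M true ⊕ 1 ⊕ n′) ≡ next n (q γ) → Shortcut γ
      q-continues-into-M γ e l = trans (agree⇒cls≡ n _ _ (agree-∷ʳ (cls≡⇒agree n′ _ _ e)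
                                   (trans (cong w (⊕-assoc (q γ) 1 n′)) (sym (cls₁≡⇒letter≡ _ _ l)))))
                                   (pre-M-next true)

      occurrences-agree : ∀ {u} m → length u ≡ m → ∀ x y → OccursAt w u x → OccursAt w u y → Agree m x y
      occurrences-agree {u} m |u|≡m x y occ occ' = factor≡⇒agree m x y (subst (λ l → factor x l ≡ factor y l) |u|≡m
        (trans (sym (occurs⇒≡factor u x occ)) (occurs⇒≡factor u y occ')))

      bispecial-joins-R-to-M : ∀ b → Bispecial w b → length b ≡ n′ → cls n′ (q true ⊕ 1) ≡ cls n′ (pre-M true ⊕ 1)
      bispecial-joins-R-to-M b
        (_ , (α , β , α≢β , (y₁ , occ₁) , (y₂ , occ₂)) , (α' , β' , α'≢β' , (x₁ , occ₁') , (x₂ , occ₂'))) |b|≡n′ =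
        begin
        cls n′ (q true ⊕ 1)      ≡⟨ right-special-class 1 n′ refl x₁ x₂
                                      (agrees x₁ x₂ (proj₁ at-x₁) (proj₁ at-x₂)) right-letters-differ ⟨
        cls n′ x₁                ≡⟨ agree⇒cls≡ n′ _ _ (agrees x₁ (y₁ ⊕ 1) (proj₁ at-x₁) (proj₂ at-y₁)) ⟩
        cls n′ (y₁ ⊕ 1)          ≡⟨ left-special-class n′ (n≤1+n n′) y₁ y₂
                                      (agrees (y₁ ⊕ 1) (y₂ ⊕ 1) (proj₂ at-y₁) (proj₂ at-y₂)) left-letters-differ ⟩
        cls n′ (pre-M true ⊕ 1)  ∎
        where
        open ≡-Reasoning
        at-y₁ : w y₁ ≡ α × OccursAt w b (y₁ ⊕ 1)
        at-y₁ = occurs-∷ α b y₁ occ₁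
        at-y₂ : w y₂ ≡ β × OccursAt w b (y₂ ⊕ 1)
        at-y₂ = occurs-∷ β b y₂ occ₂
        at-x₁ : OccursAt w b x₁ × w (x₁ ⊕ length b) ≡ α'
        at-x₁ = occurs-∷ʳ α' b x₁ occ₁'
        at-x₂ : OccursAt w b x₂ × w (x₂ ⊕ length b) ≡ β'
        at-x₂ = occurs-∷ʳ β' b x₂ occ₂'

        agrees : ∀ x y → OccursAt w b x → OccursAt w b y → Agree n′ x y
        agrees = occurrences-agree {b} n′ |b|≡n′

        left-letters-differ : w y₁ ≢ w y₂
        left-letters-differ e = α≢β (trans (sym (proj₁ at-y₁)) (trans e (proj₁ at-y₂)))

        right-letters-differ : w (x₁ ⊕ n′) ≢ w (x₂ ⊕ n′)
        right-letters-differ e = α'≢β' (trans (sym (subst (λ l → w (x₁ ⊕ l) ≡ α') |b|≡n′ (proj₂ at-x₁)))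
                                          (trans e (subst (λ l → w (x₂ ⊕ l) ≡ β') |b|≡n′ (proj₂ at-x₂))))

      bispecial⇒shortcut : ∀ b → Bispecial w b → length b ≡ n′ → ∃ Shortcut
      bispecial⇒shortcut b bs |b|≡n′ =
        continue (fin2-≢⇒≡⊎≡ (next n (q true)) (next n (q false)) (cls 1 (pre-M true ⊕ 1 ⊕ n′)) (proj₂ q-special))
        where
        joins : cls n′ (q true ⊕ 1) ≡ cls n′ (pre-M true ⊕ 1)
        joins = bispecial-joins-R-to-M b bs |b|≡n′

        continue : cls 1 (pre-M true ⊕ 1 ⊕ n′) ≡ next n (q true) ⊎ cls 1 (pre-M true ⊕ 1 ⊕ n′) ≡ next n (q false) →
                   ∃ Shortcut
        continue (inj₁ l) = true  , q-continues-into-M true joins l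
        continue (inj₂ l) = false , q-continues-into-M false (trans (cls-tail n′ _ _ (q-R false)) joins) l

      left-special⇒M : ∀ s → LeftSpecial w s → n ≤ length s → ∃ λ i → OccursAt w s i × cls n i ≡ M
      left-special⇒M s (α , β , α≢β , (y₁ , occ₁) , (y₂ , occ₂)) n≤|s| =
        y₁ ⊕ 1 , proj₂ at-y₁ ,
        trans (left-special-class n ≤-refl y₁ y₂
                (agree-≤ n≤|s| (occurrences-agree {s} (length s) refl (y₁ ⊕ 1) (y₂ ⊕ 1) (proj₂ at-y₁) (proj₂ at-y₂)))
                (λ e → α≢β (trans (sym (proj₁ at-y₁)) (trans e (proj₁ at-y₂)))))
              (pre-M-next true)
        where
        at-y₁ : w y₁ ≡ α × OccursAt w s (y₁ ⊕ 1)
        at-y₁ = occurs-∷ α s y₁ occ₁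
        at-y₂ : w y₂ ≡ β × OccursAt w s (y₂ ⊕ 1)
        at-y₂ = occurs-∷ β s y₂ occ₂

      right-special⇒R : ∀ s i → OccursAt w s i → RightSpecial w s → ∀ e → e + n ≡ length s → cls n (i ⊕ e) ≡ R
      right-special⇒R s i occ (α' , β' , α'≢β' , (x₁ , occ₁) , (x₂ , occ₂)) e e+n≡|s| = begin
        cls n (i ⊕ e)         ≡⟨ agree⇒cls≡ n _ _ (agree-drop e (agrees i x₁ occ (proj₁ at-x₁))) ⟩
        cls n (x₁ ⊕ e)        ≡⟨ right-special-class 0 n refl (x₁ ⊕ e) (x₂ ⊕ e)
                                   (agree-drop e (agrees x₁ x₂ (proj₁ at-x₁) (proj₁ at-x₂)))
                                   (λ eq → α'≢β' (trans (sym (last x₁ (proj₂ at-x₁))) (trans eq (last x₂ (proj₂ at-x₂))))) ⟩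
        cls n (q true ⊕ 0)    ≡⟨ cong (cls n) (⊕-identityʳ (q true)) ⟩
        R                     ∎
        where
        open ≡-Reasoning
        at-x₁ : OccursAt w s x₁ × w (x₁ ⊕ length s) ≡ α'
        at-x₁ = occurs-∷ʳ α' s x₁ occ₁
        at-x₂ : OccursAt w s x₂ × w (x₂ ⊕ length s) ≡ β'
        at-x₂ = occurs-∷ʳ β' s x₂ occ₂

        agrees : ∀ x y → OccursAt w s x → OccursAt w s y → Agree (e + n) x y
        agrees = occurrences-agree {s} (e + n) (sym e+n≡|s|)

        last : ∀ {a} x → w (x ⊕ length s) ≡ a → w (x ⊕ e ⊕ n) ≡ a
        last x wx≡a = trans (cong w (trans (⊕-assoc x e n) (cong (x ⊕_) e+n≡|s|))) wx≡a

      M-word-bispecial : ∀ i → cls n i ≡ M → Bispecial w (factor i (n + d))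
      M-word-bispecial i iM = (i , factor-occurs i (n + d)) , after-M-left-special i (n + d) ≤-refl iM ,
        (w (q true ⊕ n) , w (q false ⊕ n) , q-letters-differ , (q true ⊖ d , occurs true) , (q false ⊖ d , occurs false))
        where
        occurs : ∀ γ → OccursAt w (factor i (n + d) ++ [ w (q γ ⊕ n) ]) (q γ ⊖ d)
        occurs γ = subst (λ v → OccursAt w v (q γ ⊖ d))
                     (trans (factor-∷ʳ (q γ ⊖ d) (n + d))
                       (cong₂ (λ v a → v ++ [ a ])
                         (agree⇒factor≡ (n + d) _ _ (M-agree _ i (R⇒M-behind (q γ) (q-R γ)) iM))
                         (cong w (trans (cong (q γ ⊖ d ⊕_) (+-comm n d)) (x⊖a⊕[a+b]≡x⊕b (q γ) d n)))))
                     (factor-occurs (q γ ⊖ d) (suc (n + d)))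

      M-headed-right-special-long : ∀ s i → OccursAt w s i → cls n i ≡ M → RightSpecial w s →
                                    n ≤ length s → n + d ≤ length s
      M-headed-right-special-long s i occ iM rs n≤|s| = subst (n + d ≤_) (m+[n∸m]≡n n≤|s|)
        (+-monoʳ-≤ n (M-to-R i iM (length s ∸ n) (right-special⇒R s i occ rs (length s ∸ n) (m∸n+n≡m n≤|s|))))

      shortest-bispecial-is-M-word : ∀ s → Bispecial w s → n ≤ length s →
                                     (∀ t → Bispecial w t → n ≤ length t → length s ≤ length t) →
                                     ∃ λ i → cls n i ≡ M × s ≡ factor i (n + d)
      shortest-bispecial-is-M-word s (_ , ls , rs) n≤|s| shortest = at-M (left-special⇒M s ls n≤|s|)
        where
        at-M : (∃ λ i → OccursAt w s i × cls n i ≡ M) → ∃ λ i → cls n i ≡ M × s ≡ factor i (n + d)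
        at-M (i , occ , iM) = i , iM , trans (occurs⇒≡factor s i occ) (cong (factor i) (≤-antisym
          (subst (length s ≤_) (length-factor i (n + d)) (shortest _ (M-word-bispecial i iM) M-word-long))
          (M-headed-right-special-long s i occ iM rs n≤|s|)))
          where
          M-word-long : n ≤ length (factor i (n + d))
          M-word-long = subst (n ≤_) (sym (length-factor i (n + d))) (m≤m+n n d)

      quasiperiod⇔M-word-factor : (∀ γ → ¬ Shortcut γ) → ∀ i → cls n i ≡ M → ∀ u →
                                  QuasiperiodOfLength w n u ⇔ (length u ≡ n × FiniteFactor u (factor i (n + d)))
      quasiperiod⇔M-word-factor ¬sc i iM u =
        mk⇔ (λ qp → proj₁ qp , cover⇒infix (quasiperiod⇒cover u qp))
            (λ (|u|≡n , u-infix) → infix⇒quasiperiod |u|≡n (infix-factor u i (n + d) u-infix))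
        where
        M-word-window : ∀ k j → k + j ≡ d → cls n (i ⊕ k) ≡ S true j
        M-word-window k j = central-path d ≤-refl i iM k j

        cover⇒infix : (∃ λ x → u ≡ factor x n × Cover (cls n x)) → FiniteFactor u (factor i (n + d))
        cover⇒infix (x , u≡ , cover) with cover⇒central _ cover
        ... | j , j≤d , Sj≡x =
          subst (λ v → Infix _≡_ v (factor i (n + d)))
            (sym (trans u≡ (cls≡⇒factor≡ n x (i ⊕ (d ∸ j))
                             (trans (sym Sj≡x) (sym (M-word-window (d ∸ j) j (m∸n+n≡m j≤d)))))))
            (factor-infix i (d ∸ j) n (n + d) (subst (d ∸ j + n ≤_) (+-comm d n) (+-monoˡ-≤ n (m∸n≤m d j))))

        infix⇒quasiperiod : length u ≡ n → (∃ λ k → k + length u ≤ n + d × u ≡ factor (i ⊕ k) (length u)) →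
                            QuasiperiodOfLength w n u
        infix⇒quasiperiod |u|≡n (k , k+|u|≤n+d , u≡) =
          subst (QuasiperiodOfLength w n) (sym (trans u≡ (cong (factor (i ⊕ k)) |u|≡n)))
            (central⇒quasiperiod ¬sc (i ⊕ k) (d ∸ k , m∸n≤m d k , sym (M-word-window k (d ∸ k) (m+[n∸m]≡n k≤d))))
          where
          k≤d : k ≤ d
          k≤d = +-cancelʳ-≤ n k d (subst₂ _≤_ (cong (k +_) |u|≡n) (+-comm n d) k+|u|≤n+d)

    no-quasiperiod⇔bispecial : 1 ≤ n′ →
                               QCount w n 0 ⇔ (∃ λ b → Bispecial w b × length b ≡ n ∸ 1 × 0 < length b)
    no-quasiperiod⇔bispecial 1≤n′ = mk⇔ to from
      where
      to : QCount w n 0 → ∃ λ b → Bispecial w b × length b ≡ n ∸ 1 × 0 < length b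
      to ([] , _ , _ , _ , complete) with W true 1 F.≟ M | W false 1 F.≟ M
      ... | yes sc | _      = shortcut⇒bispecial true sc 1≤n′
      ... | no _   | yes sc = shortcut⇒bispecial false sc 1≤n′
      ... | no ¬sc₁ | no ¬sc₂ =
        ⊥-elim (¬Any[] (complete _ (central⇒quasiperiod ¬sc M-position (d , ≤-refl , sym C-M-position))))
        where
        ¬sc : ∀ γ → ¬ Shortcut γ
        ¬sc true  = ¬sc₁
        ¬sc false = ¬sc₂
      to (_ ∷ _ , () , _)

      from : (∃ λ b → Bispecial w b × length b ≡ n ∸ 1 × 0 < length b) → QCount w n 0
      from (b , bs , |b|≡n′ , _) with bispecial⇒shortcut b bs |b|≡n′
      ... | γ , sc = [] , refl , [] , [] , λ u qp → ⊥-elim (shortcut⇒no-quasiperiod γ sc u qp)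

    quasiperiods-are-factors-of-shortest-bispecial :
      (∃ λ u → QuasiperiodOfLength w n u) → ∀ s → Bispecial w s → n ≤ length s →
      (∀ t → Bispecial w t → n ≤ length t → length s ≤ length t) →
      ∀ u → QuasiperiodOfLength w n u ⇔ (length u ≡ n × FiniteFactor u s)
    quasiperiods-are-factors-of-shortest-bispecial (u₀ , qp₀) s bs n≤|s| shortest u
      with shortest-bispecial-is-M-word s bs n≤|s| shortest
    ... | i , iM , refl = quasiperiod⇔M-word-factor (λ γ sc → shortcut⇒no-quasiperiod γ sc u₀ qp₀) i iM u

no-empty-quasiperiod : ∀ {A : Set} (w : BiWord A) u → ¬ QuasiperiodOfLength w 0 u
no-empty-quasiperiod w u (|u|≡0 , qp) with qp (ℤ.+ 0)
... | i , _ , i≤0 , 0<i+|u| =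
  ℤP.<-irrefl refl (ℤP.<-≤-trans (subst (ℤ.+ 0 ℤ.<_) (trans (cong (i ⊕_) |u|≡0) (⊕-identityʳ i)) 0<i+|u|) i≤0)

theorem17 : {A : Set} (w : BiWord A) → Sturmian w → (n : ℕ) →
    ((2 ≤ n) →
      (QCount w n 0 ⇔ (∃[ b ] Bispecial w b × (length b ≡ n ∸ 1) × (0 < length b))))
    × ((∃[ u ] QuasiperiodOfLength w n u) →
      (s : List A) → Bispecial w s → n ≤ length s →
      ((t : List A) → Bispecial w t → n ≤ length t → length s ≤ length t) →
      (u : List A) → (QuasiperiodOfLength w n u ⇔ ((length u ≡ n) × FiniteFactor u s)))
theorem17 w sturmian zero = (λ ()) , λ (u , qp) → ⊥-elim (no-empty-quasiperiod w u qp)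
theorem17 w sturmian (suc n′) =
  (λ { (s≤s 1≤n′) → no-quasiperiod⇔bispecial 1≤n′ }) , quasiperiods-are-factors-of-shortest-bispecial
  where
  open SturmianWord w sturmian
  open Graph n′
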